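{- There are infinitely many graphs $G$ for which $\chi_{DP}(G)=3$, $P_{DP}(G,3)=P(G,3)$, and there is an $N_G\in\mathbb{N}$ such that $P_{DP}(G,m) < P(G,m)$ for all $m \geq N_G$.
   Context: Graphs are finite simple graphs. $P(G,m)$ denotes the chromatic polynomial (the number of proper colorings of $G$ with colors from $\{1,\dots,m\}$). A cover of $G$ is a triple $\mathcal{H}=(L,H,M)$ where $L$ assigns to each $v\in V(G)$ a set $L(v)=\{(v,a): a\in A_v\}$ with $A_v$ a nonempty finite set, $H$ is a graph with vertex set $\bigcup_{v} L(v)$, and $M$ assigns to each edge $uv\in E(G)$ a matching $M(uv)$ between $L(u)$ and $L(v)$, such that $H[L(u)]$ is complete for every $u$, and for distinct $u,v$ the edges of $H$ between $L(u)$ and $L(v)$ are exactly those of $M(uv)$ if $uv\in E(G)$ and none otherwise. An $\mathcal{H}$-coloring of $G$ is an independent set in $H$ of size $|V(G)|$. The cover is $m$-fold if $|L(u)|=m$ for all $u$, and full $m$-fold if moreover $|M(uv)|=m$ for every edge $uv$. $\chi_{DP}(G)$ is the least $k$ such that $G$ has an $\mathcal{H}$-coloring for every $k$-fold cover $\mathcal{H}$. $P_{DP}(G,m)$ is the minimum, over all full $m$-fold covers $\mathcal{H}$, of the number of $\mathcal{H}$-colorings of $G$. -}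

module Defs where

open import Data.Nat using (ℕ; zero; suc; _≤_; _<_; _≡ᵇ_)
open import Data.Bool using (Bool; true; false; _∧_; _∨_; not; if_then_else_; T)
open import Data.Fin using (Fin; zero; suc)
open import Data.Fin.Properties using (_≟_)
open import Data.List using (List; []; _∷_; map; concatMap; length; filterᵇ; allFin; foldr)
open import Data.Nat.ListAction using (sum)
open import Data.Product using (Σ; ∃; _×_; _,_)
open import Relation.Binary.PropositionalEquality using (_≡_; _≢_)
open import Relation.Nullary using (¬_)
open import Relation.Nullary.Decidable using (⌊_⌋)

record Graph (n : ℕ) : Set where
  field
    adj    : Fin n → Fin n → Bool
    sym    : ∀ u v → adj u v ≡ adj v u
    irrefl : ∀ v → adj v v ≡ false
open Graph public

allFuns : {A : Set} (n : ℕ) → List A → List (Fin n → A)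
allFuns zero    xs = (λ ()) ∷ []
allFuns (suc n) xs =
  concatMap (λ x → map (λ f → λ { zero → x ; (suc i) → f i }) (allFuns n xs)) xs

all : {A : Set} → (A → Bool) → List A → Bool
all p = foldr (λ x b → p x ∧ b) true

allPairsᵇ : (n : ℕ) → (Fin n → Fin n → Bool) → Bool
allPairsᵇ n p = all (λ u → all (λ v → p u v) (allFin n)) (allFin n)

isProperᵇ : ∀ {n} → Graph n → {m : ℕ} → (Fin n → Fin m) → Bool
isProperᵇ {n} G f = allPairsᵇ n (λ u v → not (adj G u v) ∨ not ⌊ f u ≟ f v ⌋)

P : ∀ {n} → Graph n → ℕ → ℕ
P {n} G m = length (filterᵇ (isProperᵇ G) (allFuns n (allFin m)))

-- L(v) = {(v,a) : a ∈ Fin m}; the cover graph H has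
-- vertex set Fin n × Fin m, with adjacency adjH u a v b between (u,a),(v,b).
-- (Any m-fold cover is isomorphic to one of this shape.)

record Cover {n} (G : Graph n) (m : ℕ) : Set where
  field
    adjH     : Fin n → Fin m → Fin n → Fin m → Bool
    symH     : ∀ u a v b → adjH u a v b ≡ adjH v b u a
    irreflH  : ∀ u a → adjH u a u a ≡ false
    clique   : ∀ u a b → a ≢ b → adjH u a u b ≡ true
    nonEdge  : ∀ u v → u ≢ v → adj G u v ≡ false → ∀ a b → adjH u a v b ≡ false
    matching : ∀ u v → adj G u v ≡ true → ∀ a b b' →
               adjH u a v b ≡ true → adjH u a v b' ≡ true → b ≡ b'
open Cover public

record FullCover {n} (G : Graph n) (m : ℕ) : Set where
  field
    cover : Cover G m
    full  : ∀ u v → adj G u v ≡ true → ∀ a → ∃ λ b → adjH cover u a v b ≡ true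
open FullCover public

Subset : ℕ → ℕ → Set
Subset n m = Fin n → Fin m → Bool

size : ∀ {n m} → Subset n m → ℕ
size {n} {m} S = sum (map (λ u → sum (map (λ a → if S u a then 1 else 0) (allFin m))) (allFin n))

isIndepᵇ : ∀ {n m} {G : Graph n} → Cover G m → Subset n m → Bool
isIndepᵇ {n} {m} 𝓗 S =
  all (λ u → all (λ a → all (λ v → all (λ b →
    not (S u a ∧ S v b ∧ adjH 𝓗 u a v b)) (allFin m)) (allFin n)) (allFin m)) (allFin n)

isHColoringᵇ : ∀ {n m} {G : Graph n} → Cover G m → Subset n m → Bool
isHColoringᵇ {n} 𝓗 S = isIndepᵇ 𝓗 S ∧ (size S ≡ᵇ n)

HColorable : ∀ {n m} {G : Graph n} → Cover G m → Set
HColorable {n} {m} 𝓗 = ∃ λ (S : Subset n m) → T (isHColoringᵇ 𝓗 S)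

numHColorings : ∀ {n m} {G : Graph n} → Cover G m → ℕ
numHColorings {n} {m} 𝓗 =
  length (filterᵇ (isHColoringᵇ 𝓗) (allFuns n (allFuns m (true ∷ false ∷ []))))

DPColorable : ∀ {n} → Graph n → ℕ → Set
DPColorable G k = (𝓗 : Cover G k) → HColorable 𝓗

-- χ_DP(G) = k : k is the least positive integer with DPColorable G k
-- (covers need nonempty lists, so k ranges over positive integers)
IsχDP : ∀ {n} → Graph n → ℕ → Set
IsχDP G k = 1 ≤ k × DPColorable G k × (∀ j → 1 ≤ j → j < k → ¬ DPColorable G j)

IsPDP : ∀ {n} → Graph n → ℕ → ℕ → Set
IsPDP G m k = (Σ (FullCover G m) λ 𝓗 → numHColorings (cover 𝓗) ≡ k)
            × ((𝓗 : FullCover G m) → k ≤ numHColorings (cover 𝓗))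

{-# OPTIONS --safe #-}
-- Γ k has the vertices 0, …, 5 with edges 01 02 14 15 23 24 34 35 45, plus k isolated vertices.
-- Deleting 0, 1, 2, … in turn, the deleted vertex has 2, 2, 2, 2, 1, 0 neighbours among those
-- remaining, and in any cover each neighbour excludes at most one colour. Hence every 3-fold cover
-- has at least 1 · 1 · 1 · 1 · 2 · 3 · 3 ^ k 𝓗-colourings, so χ_DP(Γ k) = 3 (the triangle 3 4 5
-- excludes fewer colours) and P_DP(Γ k, 3) ≥ 6 · 3 ^ k; the bound is attained by proper colourings,
-- since in the first four steps the two neighbours always carry distinct colours.
-- With m ≥ 5 colours, twisting the edge 0 2 by a transposition of two colours gives a full cover
-- whose colourings inject, but not onto, into the proper colourings.
module Submission where

open import Defs hiding (sym)
open import Data.Nat using (ℕ; zero; suc; _+_; _*_; _∸_; _≤_; _<_; z≤n; s≤s; _^_; _≡ᵇ_; _≤?_)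
open import Data.Nat.Properties hiding (_≟_; _≤?_)
open import Data.Nat.ListAction using (sum)
open import Data.Bool using (Bool; true; false; _∧_; _∨_; not; if_then_else_; T)
import Data.Bool.Properties as Bool
open import Data.Fin using (Fin; zero; suc; toℕ)
open import Data.Fin.Patterns using (0F; 1F; 2F; 3F; 4F; 5F)
open import Data.Fin.Properties using (_≟_; all?; any?; toℕ-injective) renaming (suc-injective to Fin-suc-injective)
open import Data.Vec.Functional using () renaming (_∷_ to _∷ᶠ_)
open import Data.List using (List; []; _∷_; map; concatMap; length; filterᵇ; allFin; tabulate; _++_)
open import Data.Bool.ListAction using (any)
open import Data.List.Relation.Unary.Any.Properties using (any⁻)
open import Data.List.Properties using (length-tabulate)
open import Data.List.Membership.Propositional using (_∈_)
open import Data.List.Relation.Unary.Any using (here; there)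
import Data.List.Relation.Unary.All as All
open import Data.List.Extrema.Nat using (argmin; f[argmin]≤f[xs])
open import Data.Product using (Σ; ∃; _×_; _,_; proj₁; proj₂)
open import Data.Sum using (_⊎_; inj₁; inj₂)
open import Data.Empty using (⊥; ⊥-elim)
open import Data.Unit using (tt)
open import Relation.Nullary using (¬_; Dec; yes; no)
open import Relation.Nullary.Decidable using (⌊_⌋; isYes≗does; dec-true; dec-false; does-⇔; toWitness)
open import Relation.Nullary.Decidable.Core using (_×-dec_; _→-dec_; ¬?; from-yes)
open import Relation.Binary.PropositionalEquality
open import Function.Bundles using (mk⇔; Equivalence)
open import Algebra.Properties.CommutativeSemigroup +-commutativeSemigroup using (interchange)

private
  variable
    A B : Set

𝟙 : Bool → ℕ
𝟙 true  = 1
𝟙 false = 0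

𝟙-∧ : ∀ a b → 𝟙 (a ∧ b) ≡ 𝟙 a * 𝟙 b
𝟙-∧ true  b = sym (+-identityʳ (𝟙 b))
𝟙-∧ false b = refl

∑ : (A → ℕ) → List A → ℕ
∑ f []       = 0
∑ f (x ∷ xs) = f x + ∑ f xs

count : (A → Bool) → List A → ℕ
count p = ∑ (λ x → 𝟙 (p x))

∑-cong : {f g : A → ℕ} → (∀ x → f x ≡ g x) → ∀ xs → ∑ f xs ≡ ∑ g xs
∑-cong f≡g []       = refl
∑-cong f≡g (x ∷ xs) = cong₂ _+_ (f≡g x) (∑-cong f≡g xs)

∑-mono-≤ : {f g : A → ℕ} → (∀ x → f x ≤ g x) → ∀ xs → ∑ f xs ≤ ∑ g xs
∑-mono-≤ f≤g []       = z≤n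
∑-mono-≤ f≤g (x ∷ xs) = +-mono-≤ (f≤g x) (∑-mono-≤ f≤g xs)

∑-distrib-+ : (f g : A → ℕ) → ∀ xs → ∑ (λ x → f x + g x) xs ≡ ∑ f xs + ∑ g xs
∑-distrib-+ f g []       = refl
∑-distrib-+ f g (x ∷ xs) =
  trans (cong (f x + g x +_) (∑-distrib-+ f g xs)) (interchange (f x) (g x) (∑ f xs) (∑ g xs))

∑-*ˡ : (c : ℕ) (f : A → ℕ) → ∀ xs → ∑ (λ x → c * f x) xs ≡ c * ∑ f xs
∑-*ˡ c f []       = sym (*-zeroʳ c)
∑-*ˡ c f (x ∷ xs) = trans (cong (c * f x +_) (∑-*ˡ c f xs)) (sym (*-distribˡ-+ c (f x) (∑ f xs)))

∑-const : (c : ℕ) (xs : List A) → ∑ (λ _ → c) xs ≡ c * length xs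
∑-const c []       = sym (*-zeroʳ c)
∑-const c (x ∷ xs) = trans (cong (c +_) (∑-const c xs)) (sym (*-suc c (length xs)))

∑-zero : (xs : List A) → ∑ (λ _ → 0) xs ≡ 0
∑-zero []       = refl
∑-zero (x ∷ xs) = ∑-zero xs

∑-map : (f : B → ℕ) (g : A → B) → ∀ xs → ∑ f (map g xs) ≡ ∑ (λ x → f (g x)) xs
∑-map f g []       = refl
∑-map f g (x ∷ xs) = cong (f (g x) +_) (∑-map f g xs)

∑-++ : (f : A → ℕ) → ∀ xs ys → ∑ f (xs ++ ys) ≡ ∑ f xs + ∑ f ys
∑-++ f []       ys = refl
∑-++ f (x ∷ xs) ys = trans (cong (f x +_) (∑-++ f xs ys)) (sym (+-assoc (f x) (∑ f xs) (∑ f ys)))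

∑-concatMap : (f : B → ℕ) (g : A → List B) → ∀ xs → ∑ f (concatMap g xs) ≡ ∑ (λ x → ∑ f (g x)) xs
∑-concatMap f g []       = refl
∑-concatMap f g (x ∷ xs) = trans (∑-++ f (g x) (concatMap g xs)) (cong (∑ f (g x) +_) (∑-concatMap f g xs))

∑-comm : (F : A → B → ℕ) → ∀ xs ys → ∑ (λ x → ∑ (F x) ys) xs ≡ ∑ (λ y → ∑ (λ x → F x y) xs) ys
∑-comm F []       ys = sym (∑-zero ys)
∑-comm F (x ∷ xs) ys =
  trans (cong (∑ (F x) ys +_) (∑-comm F xs ys)) (sym (∑-distrib-+ (F x) (λ y → ∑ (λ x → F x y) xs) ys))

sum-map≡∑ : (f : A → ℕ) → ∀ xs → sum (map f xs) ≡ ∑ f xs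
sum-map≡∑ f []       = refl
sum-map≡∑ f (x ∷ xs) = cong (f x +_) (sum-map≡∑ f xs)

length-filterᵇ≡count : (p : A → Bool) → ∀ xs → length (filterᵇ p xs) ≡ count p xs
length-filterᵇ≡count p []       = refl
length-filterᵇ≡count p (x ∷ xs) with p x
... | true  = cong suc (length-filterᵇ≡count p xs)
... | false = length-filterᵇ≡count p xs

count-cong : {p q : A → Bool} → (∀ x → p x ≡ q x) → ∀ xs → count p xs ≡ count q xs
count-cong p≡q = ∑-cong (λ x → cong 𝟙 (p≡q x))

count-mono : {p q : A → Bool} → (∀ x → p x ≡ true → q x ≡ true) → ∀ xs → count p xs ≤ count q xs
count-mono {p = p} {q} p⇒q = ∑-mono-≤ 𝟙-mono
  where
  𝟙-mono : ∀ x → 𝟙 (p x) ≤ 𝟙 (q x)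
  𝟙-mono x with p x | p⇒q x
  ... | false | _  = z≤n
  ... | true  | pq rewrite pq refl = ≤-refl

count-true : (xs : List A) → count (λ _ → true) xs ≡ length xs
count-true []       = refl
count-true (x ∷ xs) = cong suc (count-true xs)

count-∧ˡ : (a : Bool) (p : A → Bool) → ∀ xs → count (λ x → a ∧ p x) xs ≡ 𝟙 a * count p xs
count-∧ˡ a p xs = trans (∑-cong (λ x → 𝟙-∧ a (p x)) xs) (∑-*ˡ (𝟙 a) (λ x → 𝟙 (p x)) xs)

count≡0⊎witness : (p : A → Bool) → ∀ xs → count p xs ≡ 0 ⊎ ∃ λ x → x ∈ xs × p x ≡ true
count≡0⊎witness p []       = inj₁ refl
count≡0⊎witness p (x ∷ xs) with p x in px
... | true  = inj₂ (x , here refl , px)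
... | false with count≡0⊎witness p xs
...   | inj₁ none           = inj₁ none
...   | inj₂ (y , y∈ , py) = inj₂ (y , there y∈ , py)

count-positive : (p : A → Bool) → ∀ xs → 1 ≤ count p xs → ∃ λ x → x ∈ xs × p x ≡ true
count-positive p xs pos with count≡0⊎witness p xs
... | inj₁ none = ⊥-elim (<⇒≢ pos (sym none))
... | inj₂ w    = w

count-≤1-if-equivalent : (_≈_ : A → A → Bool) (p : A → Bool) → ∀ xs →
  (∀ a → count (λ x → x ≈ a) xs ≤ 1) → (∀ x y → p x ≡ true → p y ≡ true → x ≈ y ≡ true) →
  count p xs ≤ 1
count-≤1-if-equivalent _≈_ p xs unique all≈ with count≡0⊎witness p xs
... | inj₁ none           = ≤-trans (≤-reflexive none) z≤n
... | inj₂ (y , _ , py) = ≤-trans (count-mono (λ x px → all≈ x y px py) xs) (unique y)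

∑Fin : (n : ℕ) → (Fin n → ℕ) → ℕ
∑Fin zero    f = 0
∑Fin (suc n) f = f zero + ∑Fin n (λ i → f (suc i))

allFinᵇ : (n : ℕ) → (Fin n → Bool) → Bool
allFinᵇ zero    p = true
allFinᵇ (suc n) p = p zero ∧ allFinᵇ n (λ i → p (suc i))

∑-tabulate : {n : ℕ} (f : A → ℕ) (g : Fin n → A) → ∑ f (tabulate g) ≡ ∑Fin n (λ i → f (g i))
∑-tabulate {n = zero}  f g = refl
∑-tabulate {n = suc n} f g = cong (f (g zero) +_) (∑-tabulate f (λ i → g (suc i)))

∑-allFin : {n : ℕ} (f : Fin n → ℕ) → ∑ f (allFin n) ≡ ∑Fin n f
∑-allFin f = ∑-tabulate f (λ i → i)

all-tabulate : (p : A → Bool) {n : ℕ} (g : Fin n → A) → all p (tabulate g) ≡ allFinᵇ n (λ i → p (g i))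
all-tabulate p {zero}  g = refl
all-tabulate p {suc n} g = cong (p (g zero) ∧_) (all-tabulate p (λ i → g (suc i)))

all-allFin : {n : ℕ} (p : Fin n → Bool) → all p (allFin n) ≡ allFinᵇ n p
all-allFin p = all-tabulate p (λ i → i)

all-cong : {p q : A → Bool} → (∀ x → p x ≡ q x) → ∀ xs → all p xs ≡ all q xs
all-cong p≡q []       = refl
all-cong p≡q (x ∷ xs) = cong₂ _∧_ (p≡q x) (all-cong p≡q xs)

∑Fin-cong : ∀ n {f g : Fin n → ℕ} → (∀ i → f i ≡ g i) → ∑Fin n f ≡ ∑Fin n g
∑Fin-cong zero    f≡g = refl
∑Fin-cong (suc n) f≡g = cong₂ _+_ (f≡g zero) (∑Fin-cong n (λ i → f≡g (suc i)))

∑Fin-zero : ∀ n → ∑Fin n (λ _ → 0) ≡ 0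
∑Fin-zero zero    = refl
∑Fin-zero (suc n) = ∑Fin-zero n

∑Fin-one : ∀ n → ∑Fin n (λ _ → 1) ≡ n
∑Fin-one zero    = refl
∑Fin-one (suc n) = cong suc (∑Fin-one n)

∑Fin-≤-card : ∀ n (f : Fin n → ℕ) → (∀ i → f i ≤ 1) → ∑Fin n f ≤ n
∑Fin-≤-card zero    f f≤1 = z≤n
∑Fin-≤-card (suc n) f f≤1 = +-mono-≤ (f≤1 zero) (∑Fin-≤-card n (λ i → f (suc i)) (λ i → f≤1 (suc i)))

∑Fin-term≤ : ∀ n (f : Fin n → ℕ) i → f i ≤ ∑Fin n f
∑Fin-term≤ (suc n) f zero    = m≤m+n (f zero) _
∑Fin-term≤ (suc n) f (suc i) = ≤-trans (∑Fin-term≤ n (λ i → f (suc i)) i) (m≤n+m _ (f zero))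

∑Fin≡card⇒all-one : ∀ n (f : Fin n → ℕ) → (∀ i → f i ≤ 1) → ∑Fin n f ≡ n → ∀ i → f i ≡ 1
∑Fin≡card⇒all-one (suc n) f f≤1 sum≡ = λ
  { zero    → head≡1
  ; (suc i) → ∑Fin≡card⇒all-one n (λ i → f (suc i)) (λ i → f≤1 (suc i)) rest≡n i }
  where
  rest≤n : ∑Fin n (λ i → f (suc i)) ≤ n
  rest≤n = ∑Fin-≤-card n _ (λ i → f≤1 (suc i))
  head≡1 : f zero ≡ 1
  head≡1 = ≤-antisym (f≤1 zero)
    (+-cancelʳ-≤ n 1 (f zero) (≤-trans (≤-reflexive (sym sum≡)) (+-monoʳ-≤ (f zero) rest≤n)))
  rest≡n : ∑Fin n (λ i → f (suc i)) ≡ n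
  rest≡n = suc-injective (subst (λ z → z + ∑Fin n (λ i → f (suc i)) ≡ suc n) head≡1 sum≡)

allFinᵇ⁻ : ∀ {n} {p : Fin n → Bool} → allFinᵇ n p ≡ true → ∀ i → p i ≡ true
allFinᵇ⁻ {suc n} {p} all-p zero    = Bool.∧-conicalˡ (p zero) _ all-p
allFinᵇ⁻ {suc n} {p} all-p (suc i) = allFinᵇ⁻ (Bool.∧-conicalʳ (p zero) _ all-p) i

allFinᵇ⁺ : ∀ {n} {p : Fin n → Bool} → (∀ i → p i ≡ true) → allFinᵇ n p ≡ true
allFinᵇ⁺ {zero}  every = refl
allFinᵇ⁺ {suc n} every = cong₂ _∧_ (every zero) (allFinᵇ⁺ (λ i → every (suc i)))

allFinᵇ-false⁻ : ∀ {n} (p : Fin n → Bool) → allFinᵇ n p ≡ false → ∃ λ i → p i ≡ false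
allFinᵇ-false⁻ {suc n} p fails with p zero in p0
... | false = zero , p0
... | true with allFinᵇ-false⁻ (λ i → p (suc i)) fails
...   | i , pi = suc i , pi

allFinᵇ-cong : ∀ {n} {p q : Fin n → Bool} → (∀ i → p i ≡ q i) → allFinᵇ n p ≡ allFinᵇ n q
allFinᵇ-cong {zero}  p≡q = refl
allFinᵇ-cong {suc n} p≡q = cong₂ _∧_ (p≡q zero) (allFinᵇ-cong (λ i → p≡q (suc i)))

allFinᵇ-∧ : ∀ {n} (p q : Fin n → Bool) → allFinᵇ n (λ i → p i ∧ q i) ≡ allFinᵇ n p ∧ allFinᵇ n q
allFinᵇ-∧ {zero}  p q = refl
allFinᵇ-∧ {suc n} p q = trans (cong ((p zero ∧ q zero) ∧_) (allFinᵇ-∧ (λ i → p (suc i)) (λ i → q (suc i))))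
                              (∧-interchange (p zero) (q zero) _ _)
  where
  ∧-interchange : ∀ a b c d → (a ∧ b) ∧ (c ∧ d) ≡ (a ∧ c) ∧ (b ∧ d)
  ∧-interchange true  true  c d = refl
  ∧-interchange true  false c d = sym (Bool.∧-zeroʳ c)
  ∧-interchange false b c d = refl

all-allFin⁻ : ∀ {n} {p : Fin n → Bool} → all p (allFin n) ≡ true → ∀ i → p i ≡ true
all-allFin⁻ {p = p} all-p = allFinᵇ⁻ (trans (sym (all-allFin p)) all-p)

all-allFin⁺ : ∀ {n} {p : Fin n → Bool} → (∀ i → p i ≡ true) → all p (allFin n) ≡ true
all-allFin⁺ {p = p} every = trans (all-allFin p) (allFinᵇ⁺ every)

false≢true : false ≢ true
false≢true ()

not-true⁻ : ∀ {b} → not b ≡ true → b ≡ false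
not-true⁻ = Bool.not-injective

not-false⁻ : ∀ {b} → not b ≡ false → b ≡ true
not-false⁻ = Bool.not-injective

T⇒≡true : ∀ {b} → T b → b ≡ true
T⇒≡true = Equivalence.to Bool.T-≡

≡true⇒T : ∀ {b} → b ≡ true → T b
≡true⇒T = Equivalence.from Bool.T-≡

_==_ : ∀ {m} → Fin m → Fin m → Bool
a == b = ⌊ a ≟ b ⌋

==-refl : ∀ {m} (a : Fin m) → a == a ≡ true
==-refl a = trans (isYes≗does (a ≟ a)) (dec-true (a ≟ a) refl)

==⇒≡ : ∀ {m} {a b : Fin m} → a == b ≡ true → a ≡ b
==⇒≡ {a = a} {b} a==b = toWitness (subst T (sym a==b) tt)

≢⇒==false : ∀ {m} {a b : Fin m} → a ≢ b → a == b ≡ false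
≢⇒==false {a = a} {b} a≢b = trans (isYes≗does (a ≟ b)) (dec-false (a ≟ b) a≢b)

==-sym : ∀ {m} (a b : Fin m) → a == b ≡ b == a
==-sym a b = trans (isYes≗does (a ≟ b))
  (trans (does-⇔ (mk⇔ sym sym) (a ≟ b) (b ≟ a)) (sym (isYes≗does (b ≟ a))))

count-==-allFin : ∀ m (b : Fin m) → count (_== b) (allFin m) ≡ 1
count-==-allFin m b = trans (∑-allFin (λ a → 𝟙 (a == b))) (∑Fin-== m b)
  where
  ∑Fin-== : ∀ m (b : Fin m) → ∑Fin m (λ a → 𝟙 (a == b)) ≡ 1
  ∑Fin-== (suc m) zero    = cong suc (∑Fin-zero m)
  ∑Fin-== (suc m) (suc b) = trans (∑Fin-cong m (λ a → cong 𝟙 (suc==suc a b))) (∑Fin-== m b)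
    where
    suc==suc : ∀ {m} (a b : Fin m) → suc a == suc b ≡ a == b
    suc==suc a b with a ≟ b
    ... | yes _ = refl
    ... | no _  = refl

_==ᴮ_ : Bool → Bool → Bool
true  ==ᴮ true  = true
false ==ᴮ false = true
_     ==ᴮ _     = false

==ᴮ⇒≡ : ∀ {a b} → a ==ᴮ b ≡ true → a ≡ b
==ᴮ⇒≡ {true}  {true}  _ = refl
==ᴮ⇒≡ {false} {false} _ = refl

==ᴮ-refl : ∀ a → a ==ᴮ a ≡ true
==ᴮ-refl true  = refl
==ᴮ-refl false = refl

count-==ᴮ : ∀ b → count (_==ᴮ b) (true ∷ false ∷ []) ≡ 1
count-==ᴮ true  = refl
count-==ᴮ false = refl

RespectsPointwise : {X : Set} {n : ℕ} → ((Fin n → X) → Bool) → Set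
RespectsPointwise {n = n} p = ∀ f g → (∀ i → f i ≡ g i) → p f ≡ p g

count-allFuns-suc : {X : Set} (n : ℕ) (xs : List X) (p : (Fin (suc n) → X) → Bool) → RespectsPointwise p →
  count p (allFuns (suc n) xs) ≡ ∑ (λ x → count (λ f → p (x ∷ᶠ f)) (allFuns n xs)) xs
count-allFuns-suc n xs p resp =
  trans (∑-concatMap (λ f → 𝟙 (p f)) _ xs) (∑-cong (λ x →
    trans (∑-map (λ f → 𝟙 (p f)) _ (allFuns n xs))
          (count-cong (λ f → resp _ _ (λ { zero → refl ; (suc i) → refl })) (allFuns n xs))) xs)

count-allFuns-true : {X : Set} (xs : List X) → ∀ n → count (λ _ → true) (allFuns n xs) ≡ length xs ^ n
count-allFuns-true xs zero    = refl
count-allFuns-true xs (suc n) = begin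
  count (λ _ → true) (allFuns (suc n) xs)               ≡⟨ count-allFuns-suc n xs (λ _ → true) (λ _ _ _ → refl) ⟩
  ∑ (λ _ → count (λ _ → true) (allFuns n xs)) xs        ≡⟨ ∑-cong (λ _ → count-allFuns-true xs n) xs ⟩
  ∑ (λ _ → length xs ^ n) xs                            ≡⟨ ∑-const (length xs ^ n) xs ⟩
  length xs ^ n * length xs                             ≡⟨ *-comm (length xs ^ n) (length xs) ⟩
  length xs ^ suc n                                     ∎
  where open ≡-Reasoning

pointwiseᵇ : {X : Set} → (X → X → Bool) → {n : ℕ} → (Fin n → X) → (Fin n → X) → Bool
pointwiseᵇ _≈_ {n} f g = allFinᵇ n (λ i → f i ≈ g i)

count-allFuns-pointwise≡1 : {X : Set} (_≈_ : X → X → Bool) (xs : List X) →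
  (∀ y → count (_≈ y) xs ≡ 1) → ∀ n (g : Fin n → X) → count (λ f → pointwiseᵇ _≈_ f g) (allFuns n xs) ≡ 1
count-allFuns-pointwise≡1 _≈_ xs unique zero    g = refl
count-allFuns-pointwise≡1 _≈_ xs unique (suc n) g = begin
  count (λ f → pointwiseᵇ _≈_ f g) (allFuns (suc n) xs)
    ≡⟨ count-allFuns-suc n xs _ respects ⟩
  ∑ (λ x → count (λ f → (x ≈ g zero) ∧ pointwiseᵇ _≈_ f (λ i → g (suc i))) (allFuns n xs)) xs
    ≡⟨ ∑-cong (λ x → count-∧ˡ (x ≈ g zero) _ (allFuns n xs)) xs ⟩
  ∑ (λ x → 𝟙 (x ≈ g zero) * count (λ f → pointwiseᵇ _≈_ f (λ i → g (suc i))) (allFuns n xs)) xs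
    ≡⟨ ∑-cong (λ x → cong (𝟙 (x ≈ g zero) *_) (count-allFuns-pointwise≡1 _≈_ xs unique n (λ i → g (suc i)))) xs ⟩
  ∑ (λ x → 𝟙 (x ≈ g zero) * 1) xs
    ≡⟨ ∑-cong (λ x → *-identityʳ _) xs ⟩
  count (_≈ g zero) xs
    ≡⟨ unique (g zero) ⟩
  1 ∎
  where
  open ≡-Reasoning
  respects : RespectsPointwise (λ f → pointwiseᵇ _≈_ f g)
  respects f f′ f≡f′ = allFinᵇ-cong (λ i → cong (_≈ g i) (f≡f′ i))

-- Functions can only be compared pointwise, hence the Boolean equivalences ≈ᴬ and ≈ᴮ in place of ≡.
module CountAlongInjection
  (p : A → Bool) (q : B → Bool) (_≈ᴬ_ : A → A → Bool) (_≈ᴮ_ : B → B → Bool)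
  (h : A → B) (xs : List A) (ys : List B)
  (xs-unique : ∀ a → count (_≈ᴬ a) xs ≤ 1)
  (ys-complete : ∀ b → 1 ≤ count (_≈ᴮ b) ys)
  (q-respects : ∀ y b → y ≈ᴮ b ≡ true → q b ≡ true → q y ≡ true)
  (h-maps : ∀ x → p x ≡ true → q (h x) ≡ true)
  (h-injective : ∀ y x x′ → p x ≡ true → p x′ ≡ true → y ≈ᴮ h x ≡ true → y ≈ᴮ h x′ ≡ true → x ≈ᴬ x′ ≡ true)
  where

  preimages : B → ℕ
  preimages y = count (λ x → p x ∧ y ≈ᴮ h x) xs

  preimages≤1 : ∀ y → preimages y ≤ 1
  preimages≤1 y = count-≤1-if-equivalent _≈ᴬ_ _ xs xs-unique λ x x′ px px′ →
    h-injective y x x′ (Bool.∧-conicalˡ _ _ px) (Bool.∧-conicalˡ _ _ px′)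
                       (Bool.∧-conicalʳ (p x) _ px) (Bool.∧-conicalʳ (p x′) _ px′)

  count≤∑preimages : count p xs ≤ ∑ (λ y → 𝟙 (q y) * preimages y) ys
  count≤∑preimages = begin
    count p xs
      ≤⟨ ∑-mono-≤ has-image xs ⟩
    ∑ (λ x → ∑ (λ y → 𝟙 (p x) * 𝟙 (q y ∧ y ≈ᴮ h x)) ys) xs
      ≡⟨ ∑-comm _ xs ys ⟩
    ∑ (λ y → ∑ (λ x → 𝟙 (p x) * 𝟙 (q y ∧ y ≈ᴮ h x)) xs) ys
      ≡⟨ ∑-cong (λ y → trans (∑-cong (λ x → 𝟙-swap (p x) (q y) (y ≈ᴮ h x)) xs)
                              (∑-*ˡ (𝟙 (q y)) (λ x → 𝟙 (p x ∧ y ≈ᴮ h x)) xs)) ys ⟩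
    ∑ (λ y → 𝟙 (q y) * preimages y) ys ∎
    where
    open ≤-Reasoning
    has-image : ∀ x → 𝟙 (p x) ≤ ∑ (λ y → 𝟙 (p x) * 𝟙 (q y ∧ y ≈ᴮ h x)) ys
    has-image x with p x in px
    ... | false = z≤n
    ... | true  = ≤-trans (ys-complete (h x)) (≤-trans
      (count-mono (λ y y≈hx → cong₂ _∧_ (q-respects y (h x) y≈hx (h-maps x px)) y≈hx) ys)
      (≤-reflexive (∑-cong (λ y → sym (+-identityʳ _)) ys)))
    𝟙-swap : ∀ a b c → 𝟙 a * 𝟙 (b ∧ c) ≡ 𝟙 b * 𝟙 (a ∧ c)
    𝟙-swap true  true  c = refl
    𝟙-swap true  false c = refl
    𝟙-swap false true  c = refl
    𝟙-swap false false c = refl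

  count-≤ : count p xs ≤ count q ys
  count-≤ = ≤-trans count≤∑preimages (∑-mono-≤ (λ y →
    ≤-trans (*-monoʳ-≤ (𝟙 (q y)) (preimages≤1 y)) (≤-reflexive (*-identityʳ _))) ys)

  count-< : (y₀ : B) → q y₀ ≡ true → (∀ y x → y ≈ᴮ y₀ ≡ true → p x ≡ true → y ≈ᴮ h x ≡ false) →
            count p xs < count q ys
  count-< y₀ qy₀ y₀-missed = begin-strict
    count p xs
      ≤⟨ count≤∑preimages ⟩
    ∑ (λ y → 𝟙 (q y) * preimages y) ys
      <⟨ m<m+n _ y₀-listed ⟩
    ∑ (λ y → 𝟙 (q y) * preimages y) ys + count (λ y → q y ∧ y ≈ᴮ y₀) ys
      ≡⟨ sym (∑-distrib-+ _ _ ys) ⟩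
    ∑ (λ y → 𝟙 (q y) * preimages y + 𝟙 (q y ∧ y ≈ᴮ y₀)) ys
      ≤⟨ ∑-mono-≤ at-most-one ys ⟩
    count q ys ∎
    where
    open ≤-Reasoning
    y₀-listed : 1 ≤ count (λ y → q y ∧ y ≈ᴮ y₀) ys
    y₀-listed = ≤-trans (ys-complete y₀) (count-mono (λ y y≈y₀ → cong₂ _∧_ (q-respects y y₀ y≈y₀ qy₀) y≈y₀) ys)
    no-preimage : ∀ y → y ≈ᴮ y₀ ≡ true → preimages y ≡ 0
    no-preimage y y≈y₀ = trans (count-cong pointwise xs) (∑-zero xs)
      where
      pointwise : ∀ x → (p x ∧ y ≈ᴮ h x) ≡ false
      pointwise x with p x in px
      ... | false = refl
      ... | true  = y₀-missed y x y≈y₀ px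
    at-most-one : ∀ y → 𝟙 (q y) * preimages y + 𝟙 (q y ∧ y ≈ᴮ y₀) ≤ 𝟙 (q y)
    at-most-one y with y ≈ᴮ y₀ in y≈y₀
    ... | true  rewrite no-preimage y y≈y₀ | *-zeroʳ (𝟙 (q y)) | Bool.∧-identityʳ (q y) = ≤-refl
    ... | false rewrite Bool.∧-zeroʳ (q y) | +-identityʳ (𝟙 (q y) * preimages y) =
      ≤-trans (*-monoʳ-≤ (𝟙 (q y)) (preimages≤1 y)) (≤-reflexive (*-identityʳ _))

-- Covers and their transversals

CoverAdj : ℕ → ℕ → Set
CoverAdj n m = Fin n → Fin m → Fin n → Fin m → Bool

-- c picks the vertex (u , c u) of each fibre L(u); it is an 𝓗-colouring when these are independent.
isTransversalᵇ : ∀ {n m} → CoverAdj n m → (Fin n → Fin m) → Bool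
isTransversalᵇ {n} R c = allFinᵇ n (λ u → allFinᵇ n (λ v → not (R u (c u) v (c v))))

colourings : (n m : ℕ) → List (Fin n → Fin m)
colourings n m = allFuns n (allFin m)

subsets : (n m : ℕ) → List (Subset n m)
subsets n m = allFuns n (allFuns m (true ∷ false ∷ []))

numTransversals : ∀ {n m} → CoverAdj n m → ℕ
numTransversals {n} {m} R = count (isTransversalᵇ R) (colourings n m)

isTransversalᵇ⁻ : ∀ {n m} {R : CoverAdj n m} {c} → isTransversalᵇ R c ≡ true → ∀ u v → R u (c u) v (c v) ≡ false
isTransversalᵇ⁻ transversal u v = not-true⁻ (allFinᵇ⁻ (allFinᵇ⁻ transversal u) v)

isTransversalᵇ⁺ : ∀ {n m} {R : CoverAdj n m} {c} → (∀ u v → R u (c u) v (c v) ≡ false) → isTransversalᵇ R c ≡ true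
isTransversalᵇ⁺ independent = allFinᵇ⁺ (λ u → allFinᵇ⁺ (λ v → cong not (independent u v)))

isTransversalᵇ-respects : ∀ {n m} (R : CoverAdj n m) → RespectsPointwise (isTransversalᵇ R)
isTransversalᵇ-respects R c c′ c≡c′ =
  allFinᵇ-cong (λ u → allFinᵇ-cong (λ v → cong₂ (λ a b → not (R u a v b)) (c≡c′ u) (c≡c′ v)))

colourings-unique : ∀ n m (c : Fin n → Fin m) → count (λ c′ → pointwiseᵇ _==_ c′ c) (colourings n m) ≡ 1
colourings-unique n m c = count-allFuns-pointwise≡1 _==_ (allFin m) (count-==-allFin m) n c

subsets-unique : ∀ n m (S : Subset n m) → count (λ S′ → pointwiseᵇ (pointwiseᵇ _==ᴮ_) S′ S) (subsets n m) ≡ 1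
subsets-unique n m S = count-allFuns-pointwise≡1 _ _
  (λ row → count-allFuns-pointwise≡1 _==ᴮ_ (true ∷ false ∷ []) count-==ᴮ m row) n S

pointwise-==⁻ : ∀ {n m} (c c′ : Fin n → Fin m) → pointwiseᵇ _==_ c c′ ≡ true → ∀ u → c u ≡ c′ u
pointwise-==⁻ c c′ c≈c′ u = ==⇒≡ (allFinᵇ⁻ c≈c′ u)

pointwise-==⁺ : ∀ {n m} {c c′ : Fin n → Fin m} → (∀ u → c u ≡ c′ u) → pointwiseᵇ _==_ c c′ ≡ true
pointwise-==⁺ {c = c} c≡c′ = allFinᵇ⁺ (λ u → subst (λ z → c u == z ≡ true) (c≡c′ u) (==-refl (c u)))

pointwise-==ᴮ⁻ : ∀ {n m} (S S′ : Subset n m) → pointwiseᵇ (pointwiseᵇ _==ᴮ_) S S′ ≡ true → ∀ u a → S u a ≡ S′ u a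
pointwise-==ᴮ⁻ S S′ S≈S′ u a = ==ᴮ⇒≡ (allFinᵇ⁻ (allFinᵇ⁻ S≈S′ u) a)

pointwise-==ᴮ⁺ : ∀ {n m} {S S′ : Subset n m} → (∀ u a → S u a ≡ S′ u a) → pointwiseᵇ (pointwiseᵇ _==ᴮ_) S S′ ≡ true
pointwise-==ᴮ⁺ {S = S} S≡S′ =
  allFinᵇ⁺ (λ u → allFinᵇ⁺ (λ a → subst (λ z → S u a ==ᴮ z ≡ true) (S≡S′ u a) (==ᴮ-refl (S u a))))

size≡∑Fin : ∀ {n m} (S : Subset n m) → size S ≡ ∑Fin n (λ u → ∑Fin m (λ a → 𝟙 (S u a)))
size≡∑Fin {n} {m} S = begin
  sum (map (λ u → sum (map (λ a → if S u a then 1 else 0) (allFin m))) (allFin n))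
    ≡⟨ sum-map≡∑ _ (allFin n) ⟩
  ∑ (λ u → sum (map (λ a → if S u a then 1 else 0) (allFin m))) (allFin n)
    ≡⟨ ∑-allFin {n} _ ⟩
  ∑Fin n (λ u → sum (map (λ a → if S u a then 1 else 0) (allFin m)))
    ≡⟨ ∑Fin-cong n (λ u → trans (sum-map≡∑ _ (allFin m)) (trans (∑-allFin {m} _) (∑Fin-cong m (λ a → if≡𝟙 (S u a))))) ⟩
  ∑Fin n (λ u → ∑Fin m (λ a → 𝟙 (S u a))) ∎
  where
  open ≡-Reasoning
  if≡𝟙 : ∀ b → (if b then 1 else 0) ≡ 𝟙 b
  if≡𝟙 true  = refl
  if≡𝟙 false = refl

graphOf : ∀ {n m} → (Fin n → Fin m) → Subset n m
graphOf c u a = a == c u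

module _ {n m : ℕ} {G : Graph n} (𝓗 : Cover G m) where

  isIndepᵇ⁻ : ∀ {S} → isIndepᵇ 𝓗 S ≡ true → ∀ u a v b → (S u a ∧ S v b ∧ adjH 𝓗 u a v b) ≡ false
  isIndepᵇ⁻ indep u a v b = not-true⁻ (all-allFin⁻ (all-allFin⁻ (all-allFin⁻ (all-allFin⁻ indep u) a) v) b)

  isIndepᵇ⁺ : ∀ {S} → (∀ u a v b → (S u a ∧ S v b ∧ adjH 𝓗 u a v b) ≡ false) → isIndepᵇ 𝓗 S ≡ true
  isIndepᵇ⁺ indep = all-allFin⁺ (λ u → all-allFin⁺ (λ a → all-allFin⁺ (λ v → all-allFin⁺ (λ b → cong not (indep u a v b)))))

  isHColoringᵇ-respects : (S S′ : Subset n m) → (∀ u a → S u a ≡ S′ u a) → isHColoringᵇ 𝓗 S ≡ isHColoringᵇ 𝓗 S′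
  isHColoringᵇ-respects S S′ S≡S′ = cong₂ _∧_
    (all-cong (λ u → all-cong (λ a → all-cong (λ v → all-cong (λ b →
      cong₂ (λ x y → not (x ∧ y ∧ adjH 𝓗 u a v b)) (S≡S′ u a) (S≡S′ v b)) (allFin m)) (allFin n)) (allFin m)) (allFin n))
    (cong (_≡ᵇ n) (trans (size≡∑Fin S)
      (trans (∑Fin-cong n (λ u → ∑Fin-cong m (λ a → cong 𝟙 (S≡S′ u a)))) (sym (size≡∑Fin S′)))))

  graphOf-HColoring : ∀ c → isTransversalᵇ (adjH 𝓗) c ≡ true → isHColoringᵇ 𝓗 (graphOf c) ≡ true
  graphOf-HColoring c transversal =
    cong₂ _∧_ (isIndepᵇ⁺ {graphOf c} independent) (T⇒≡true (≡⇒≡ᵇ (size (graphOf c)) n size≡n))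
    where
    independent : ∀ u a v b → (a == c u ∧ b == c v ∧ adjH 𝓗 u a v b) ≡ false
    independent u a v b with a ≟ c u | b ≟ c v
    ... | no _      | _         = refl
    ... | yes _     | no _      = refl
    ... | yes refl  | yes refl  = isTransversalᵇ⁻ {R = adjH 𝓗} transversal u v
    size≡n : size (graphOf c) ≡ n
    size≡n = trans (size≡∑Fin (graphOf c)) (trans (∑Fin-cong n (λ u →
      trans (sym (∑-allFin {m} (λ a → 𝟙 (a == c u)))) (count-==-allFin m (c u)))) (∑Fin-one n))

-- The vertex of S in the fibre L(u), or the junk value zero when there is none.
choice : ∀ {n m} → Subset n (suc m) → Fin n → Fin (suc m)
choice S u with any? (λ a → S u a Bool.≟ true)
... | yes (a , _) = a
... | no _        = zero

choice-∈ : ∀ {n m} (S : Subset n (suc m)) u a → S u a ≡ true → S u (choice S u) ≡ true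
choice-∈ S u a a∈S with any? (λ a → S u a Bool.≟ true)
... | yes (_ , b∈S) = b∈S
... | no none       = ⊥-elim (none (a , a∈S))

module FibresOfHColoring {n m : ℕ} {G : Graph n} (𝓗 : Cover G (suc m)) {S : Subset n (suc m)}
  (hcol : isHColoringᵇ 𝓗 S ≡ true) where

  independent : ∀ u a v b → (S u a ∧ S v b ∧ adjH 𝓗 u a v b) ≡ false
  independent = isIndepᵇ⁻ 𝓗 {S} (Bool.∧-conicalˡ _ _ hcol)

  fibre-unique : ∀ u a b → S u a ≡ true → S u b ≡ true → a ≡ b
  fibre-unique u a b a∈S b∈S with a ≟ b
  ... | yes a≡b = a≡b
  ... | no  a≢b = ⊥-elim (false≢true (trans (sym (independent u a u b))
                    (trans (cong₂ (λ x y → x ∧ y ∧ adjH 𝓗 u a u b) a∈S b∈S) (clique 𝓗 u a b a≢b))))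

  fibre-size≤1 : ∀ u → ∑Fin (suc m) (λ a → 𝟙 (S u a)) ≤ 1
  fibre-size≤1 u = ≤-trans (≤-reflexive (sym (∑-allFin (λ a → 𝟙 (S u a)))))
    (count-≤1-if-equivalent _==_ (S u) (allFin (suc m)) (λ a → ≤-reflexive (count-==-allFin (suc m) a))
      (λ a b a∈S b∈S → subst (λ z → a == z ≡ true) (fibre-unique u a b a∈S b∈S) (==-refl a)))

  fibre-size≡1 : ∀ u → ∑Fin (suc m) (λ a → 𝟙 (S u a)) ≡ 1
  fibre-size≡1 = ∑Fin≡card⇒all-one n _ fibre-size≤1
    (trans (sym (size≡∑Fin S)) (≡ᵇ⇒≡ _ _ (≡true⇒T (Bool.∧-conicalʳ (isIndepᵇ 𝓗 S) _ hcol))))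

  choice-∈S : ∀ u → S u (choice S u) ≡ true
  choice-∈S u = choice-∈ S u a a∈S
    where
    positive = count-positive (S u) (allFin (suc m)) (≤-reflexive (sym (trans (∑-allFin {suc m} _) (fibre-size≡1 u))))
    a = proj₁ positive
    a∈S = proj₂ (proj₂ positive)

  S≡graphOf-choice : ∀ u a → S u a ≡ graphOf (choice S) u a
  S≡graphOf-choice u a with S u a in a∈S | a ≟ choice S u
  ... | true  | yes _ = refl
  ... | true  | no a≢choice = ⊥-elim (a≢choice (fibre-unique u a (choice S u) a∈S (choice-∈S u)))
  ... | false | yes refl = ⊥-elim (false≢true (trans (sym a∈S) (choice-∈S u)))
  ... | false | no _ = refl

  choice-transversal : isTransversalᵇ (adjH 𝓗) (choice S) ≡ true
  choice-transversal = isTransversalᵇ⁺ {R = adjH 𝓗} λ u v →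
    trans (sym (cong₂ (λ x y → x ∧ y ∧ adjH 𝓗 u (choice S u) v (choice S v)) (choice-∈S u) (choice-∈S v)))
          (independent u (choice S u) v (choice S v))

-- Both maps graphOf and choice are injective, so the two counts agree.
numHColorings≡numTransversals : ∀ {n m} {G : Graph n} (𝓗 : Cover G (suc m)) →
  numHColorings 𝓗 ≡ numTransversals (adjH 𝓗)
numHColorings≡numTransversals {n} {m} 𝓗 =
  trans (length-filterᵇ≡count _ (subsets n (suc m))) (≤-antisym viaChoice.count-≤ viaGraph.count-≤)
  where
  open FibresOfHColoring 𝓗 using (choice-transversal; S≡graphOf-choice)
  module viaGraph = CountAlongInjection (isTransversalᵇ (adjH 𝓗)) (isHColoringᵇ 𝓗)
    (pointwiseᵇ _==_) (pointwiseᵇ (pointwiseᵇ _==ᴮ_)) graphOf (colourings n (suc m)) (subsets n (suc m))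
    (λ c → ≤-reflexive (colourings-unique n (suc m) c)) (λ S → ≤-reflexive (sym (subsets-unique n (suc m) S)))
    (λ S S′ S≈S′ → trans (isHColoringᵇ-respects 𝓗 S S′ (pointwise-==ᴮ⁻ S S′ S≈S′)))
    (graphOf-HColoring 𝓗)
    (λ S c c′ _ _ S≈c S≈c′ → pointwise-==⁺ (λ u → ==⇒≡
      (trans (sym (pointwise-==ᴮ⁻ S (graphOf c′) S≈c′ u (c u)))
             (trans (pointwise-==ᴮ⁻ S (graphOf c) S≈c u (c u)) (==-refl (c u))))))
  module viaChoice = CountAlongInjection (isHColoringᵇ 𝓗) (isTransversalᵇ (adjH 𝓗))
    (pointwiseᵇ (pointwiseᵇ _==ᴮ_)) (pointwiseᵇ _==_) choice (subsets n (suc m)) (colourings n (suc m))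
    (λ S → ≤-reflexive (subsets-unique n (suc m) S)) (λ c → ≤-reflexive (sym (colourings-unique n (suc m) c)))
    (λ c c′ c≈c′ → trans (isTransversalᵇ-respects (adjH 𝓗) c c′ (pointwise-==⁻ c c′ c≈c′)))
    (λ S hcol → choice-transversal hcol)
    (λ c S S′ hcol hcol′ c≈ c≈′ → pointwise-==ᴮ⁺ (λ u a →
      trans (S≡graphOf-choice hcol u a)
        (trans (cong (a ==_) (trans (sym (pointwise-==⁻ c (choice S) c≈ u)) (pointwise-==⁻ c (choice S′) c≈′ u)))
            (sym (S≡graphOf-choice hcol′ u a)))))

-- Peeling off vertex zero

restrict : ∀ {n m} → CoverAdj (suc n) m → CoverAdj n m
restrict R u a v b = R (suc u) a (suc v) b

compatible : ∀ {n m} → CoverAdj (suc n) m → Fin m → (Fin n → Fin m) → Bool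
compatible {n} R x f =
  not (R zero x zero x) ∧ allFinᵇ n (λ v → not (R zero x (suc v) (f v))) ∧ allFinᵇ n (λ v → not (R (suc v) (f v) zero x))

isTransversalᵇ-∷ : ∀ {n m} (R : CoverAdj (suc n) m) x f →
  isTransversalᵇ R (x ∷ᶠ f) ≡ compatible R x f ∧ isTransversalᵇ (restrict R) f
isTransversalᵇ-∷ {n} R x f =
  trans (cong ((not (R zero x zero x) ∧ allFinᵇ n (λ v → not (R zero x (suc v) (f v)))) ∧_)
              (allFinᵇ-∧ (λ u → not (R (suc u) (f u) zero x)) (λ u → allFinᵇ n (λ v → not (R (suc u) (f u) (suc v) (f v))))))
        (reassociate (not (R zero x zero x)) _ _ _)
  where
  reassociate : ∀ a b c d → (a ∧ b) ∧ (c ∧ d) ≡ (a ∧ b ∧ c) ∧ d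
  reassociate true  b c d = sym (Bool.∧-assoc b c d)
  reassociate false b c d = refl

numTransversals-∷ : ∀ {n m} (R : CoverAdj (suc n) m) → numTransversals R ≡
  ∑ (λ f → 𝟙 (isTransversalᵇ (restrict R) f) * count (λ x → compatible R x f) (allFin m)) (colourings n m)
numTransversals-∷ {n} {m} R = begin
  count (isTransversalᵇ R) (colourings (suc n) m)
    ≡⟨ count-allFuns-suc n (allFin m) (isTransversalᵇ R) (isTransversalᵇ-respects R) ⟩
  ∑ (λ x → count (λ f → isTransversalᵇ R (x ∷ᶠ f)) (colourings n m)) (allFin m)
    ≡⟨ ∑-cong (λ x → ∑-cong (λ f → split x f) (colourings n m)) (allFin m) ⟩
  ∑ (λ x → ∑ (λ f → 𝟙 (isTransversalᵇ (restrict R) f) * 𝟙 (compatible R x f)) (colourings n m)) (allFin m)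
    ≡⟨ ∑-comm _ (allFin m) (colourings n m) ⟩
  ∑ (λ f → ∑ (λ x → 𝟙 (isTransversalᵇ (restrict R) f) * 𝟙 (compatible R x f)) (allFin m)) (colourings n m)
    ≡⟨ ∑-cong (λ f → ∑-*ˡ (𝟙 (isTransversalᵇ (restrict R) f)) _ (allFin m)) (colourings n m) ⟩
  ∑ (λ f → 𝟙 (isTransversalᵇ (restrict R) f) * count (λ x → compatible R x f) (allFin m)) (colourings n m) ∎
  where
  open ≡-Reasoning
  split : ∀ x f → 𝟙 (isTransversalᵇ R (x ∷ᶠ f)) ≡ 𝟙 (isTransversalᵇ (restrict R) f) * 𝟙 (compatible R x f)
  split x f = trans (cong 𝟙 (isTransversalᵇ-∷ R x f))
                    (trans (𝟙-∧ (compatible R x f) _) (*-comm (𝟙 (compatible R x f)) _))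

numTransversals-∷-≥ : ∀ {n m} (R : CoverAdj (suc n) m) (L : ℕ) →
  (∀ f → isTransversalᵇ (restrict R) f ≡ true → L ≤ count (λ x → compatible R x f) (allFin m)) →
  L * numTransversals (restrict R) ≤ numTransversals R
numTransversals-∷-≥ {n} {m} R L enough = begin
  L * numTransversals (restrict R)
    ≡⟨ sym (∑-*ˡ L _ (colourings n m)) ⟩
  ∑ (λ f → L * 𝟙 (isTransversalᵇ (restrict R) f)) (colourings n m)
    ≤⟨ ∑-mono-≤ termwise (colourings n m) ⟩
  ∑ (λ f → 𝟙 (isTransversalᵇ (restrict R) f) * count (λ x → compatible R x f) (allFin m)) (colourings n m)
    ≡⟨ sym (numTransversals-∷ R) ⟩
  numTransversals R ∎
  where
  open ≤-Reasoning
  termwise : ∀ f → L * 𝟙 (isTransversalᵇ (restrict R) f) ≤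
                   𝟙 (isTransversalᵇ (restrict R) f) * count (λ x → compatible R x f) (allFin m)
  termwise f with isTransversalᵇ (restrict R) f in transversal
  ... | false = ≤-reflexive (*-zeroʳ L)
  ... | true  = ≤-trans (≤-reflexive (*-identityʳ L)) (≤-trans (enough f transversal) (≤-reflexive (sym (+-identityʳ _))))

numTransversals-∷-≤ : ∀ {n m} (R : CoverAdj (suc n) m) (U : ℕ) →
  (∀ f → isTransversalᵇ (restrict R) f ≡ true → count (λ x → compatible R x f) (allFin m) ≤ U) →
  numTransversals R ≤ U * numTransversals (restrict R)
numTransversals-∷-≤ {n} {m} R U few = begin
  numTransversals R
    ≡⟨ numTransversals-∷ R ⟩
  ∑ (λ f → 𝟙 (isTransversalᵇ (restrict R) f) * count (λ x → compatible R x f) (allFin m)) (colourings n m)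
    ≤⟨ ∑-mono-≤ termwise (colourings n m) ⟩
  ∑ (λ f → U * 𝟙 (isTransversalᵇ (restrict R) f)) (colourings n m)
    ≡⟨ ∑-*ˡ U _ (colourings n m) ⟩
  U * numTransversals (restrict R) ∎
  where
  open ≤-Reasoning
  termwise : ∀ f → 𝟙 (isTransversalᵇ (restrict R) f) * count (λ x → compatible R x f) (allFin m) ≤
                   U * 𝟙 (isTransversalᵇ (restrict R) f)
  termwise f with isTransversalᵇ (restrict R) f in transversal
  ... | false = ≤-reflexive (sym (*-zeroʳ U))
  ... | true  = ≤-trans (≤-reflexive (+-identityʳ _)) (≤-trans (few f transversal) (≤-reflexive (sym (*-identityʳ U))))

term≤∑-allFin : ∀ {n} (f : Fin n → ℕ) i → f i ≤ ∑ f (allFin n)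
term≤∑-allFin {n} f i = ≤-trans (∑Fin-term≤ n f i) (≤-reflexive (sym (∑-allFin f)))

tailGraph : ∀ {n} → Graph (suc n) → Graph n
tailGraph G = record
  { adj    = λ u v → adj G (suc u) (suc v)
  ; sym    = λ u v → Graph.sym G (suc u) (suc v)
  ; irrefl = λ v → irrefl G (suc v)
  }

tailCover : ∀ {n m} {G : Graph (suc n)} → Cover G m → Cover (tailGraph G) m
tailCover 𝓗 = record
  { adjH     = restrict (adjH 𝓗)
  ; symH     = λ u a v b → symH 𝓗 (suc u) a (suc v) b
  ; irreflH  = λ u → irreflH 𝓗 (suc u)
  ; clique   = λ u → clique 𝓗 (suc u)
  ; nonEdge  = λ u v u≢v → nonEdge 𝓗 (suc u) (suc v) (λ su≡sv → u≢v (Fin-suc-injective su≡sv))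
  ; matching = λ u v → matching 𝓗 (suc u) (suc v)
  }

degree₀ : ∀ {n} → Graph (suc n) → ℕ
degree₀ {n} G = ∑Fin n (λ v → 𝟙 (adj G zero (suc v)))

-- Each neighbour of vertex zero excludes at most one colour there, by the matching condition.
module PeelLowerBound {n m : ℕ} {G : Graph (suc n)} (𝓗 : Cover G m) where

  conflict : Fin m → (Fin n → Fin m) → Fin n → Bool
  conflict x f v = adjH 𝓗 zero x (suc v) (f v)

  compatible≡no-conflict : ∀ x f → compatible (adjH 𝓗) x f ≡ allFinᵇ n (λ v → not (conflict x f v))
  compatible≡no-conflict x f rewrite irreflH 𝓗 zero x =
    trans (cong (allFinᵇ n (λ v → not (conflict x f v)) ∧_)
                (allFinᵇ-cong (λ v → cong not (symH 𝓗 (suc v) (f v) zero x))))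
          (Bool.∧-idem _)

  conflicts≤adjacent : ∀ f v → count (λ x → conflict x f v) (allFin m) ≤ 𝟙 (adj G zero (suc v))
  conflicts≤adjacent f v with adj G zero (suc v) in adjacent
  ... | false = ≤-reflexive (trans (count-cong (λ x → nonEdge 𝓗 zero (suc v) (λ ()) adjacent x (f v)) (allFin m))
                                   (∑-zero (allFin m)))
  ... | true  = count-≤1-if-equivalent _==_ _ (allFin m) (λ a → ≤-reflexive (count-==-allFin m a))
    λ x x′ x-conflict x′-conflict → subst (λ z → x == z ≡ true)
      (matching 𝓗 (suc v) zero (trans (Graph.sym G (suc v) zero) adjacent) (f v) x x′
         (trans (symH 𝓗 (suc v) (f v) zero x) x-conflict) (trans (symH 𝓗 (suc v) (f v) zero x′) x′-conflict))
      (==-refl x)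

  compatible-or-conflict : ∀ f x → 1 ≤ 𝟙 (compatible (adjH 𝓗) x f) + ∑ (λ v → 𝟙 (conflict x f v)) (allFin n)
  compatible-or-conflict f x with compatible (adjH 𝓗) x f in compatible?
  ... | true  = s≤s z≤n
  ... | false with allFinᵇ-false⁻ _ (trans (sym (compatible≡no-conflict x f)) compatible?)
  ...   | v , no-conflict = ≤-trans (≤-reflexive (cong 𝟙 (sym (not-false⁻ no-conflict))))
                                    (term≤∑-allFin (λ v → 𝟙 (conflict x f v)) v)

  colours≤degree+compatible : ∀ f → m ≤ degree₀ G + count (λ x → compatible (adjH 𝓗) x f) (allFin m)
  colours≤degree+compatible f = begin
    m
      ≡⟨ sym (trans (count-true (allFin m)) (length-tabulate (λ x → x))) ⟩
    count (λ _ → true) (allFin m)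
      ≤⟨ ∑-mono-≤ (compatible-or-conflict f) (allFin m) ⟩
    ∑ (λ x → 𝟙 (compatible (adjH 𝓗) x f) + ∑ (λ v → 𝟙 (conflict x f v)) (allFin n)) (allFin m)
      ≡⟨ ∑-distrib-+ _ _ (allFin m) ⟩
    count (λ x → compatible (adjH 𝓗) x f) (allFin m) + ∑ (λ x → ∑ (λ v → 𝟙 (conflict x f v)) (allFin n)) (allFin m)
      ≡⟨ cong (count (λ x → compatible (adjH 𝓗) x f) (allFin m) +_) (∑-comm _ (allFin m) (allFin n)) ⟩
    count (λ x → compatible (adjH 𝓗) x f) (allFin m) + ∑ (λ v → count (λ x → conflict x f v) (allFin m)) (allFin n)
      ≤⟨ +-monoʳ-≤ _ (∑-mono-≤ (conflicts≤adjacent f) (allFin n)) ⟩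
    count (λ x → compatible (adjH 𝓗) x f) (allFin m) + ∑ (λ v → 𝟙 (adj G zero (suc v))) (allFin n)
      ≡⟨ cong (count (λ x → compatible (adjH 𝓗) x f) (allFin m) +_) (∑-allFin {n} _) ⟩
    count (λ x → compatible (adjH 𝓗) x f) (allFin m) + degree₀ G
      ≡⟨ +-comm _ (degree₀ G) ⟩
    degree₀ G + count (λ x → compatible (adjH 𝓗) x f) (allFin m) ∎
    where open ≤-Reasoning

  numTransversals-tail-≥ : (m ∸ degree₀ G) * numTransversals (adjH (tailCover 𝓗)) ≤ numTransversals (adjH 𝓗)
  numTransversals-tail-≥ = numTransversals-∷-≥ (adjH 𝓗) (m ∸ degree₀ G)
    (λ f _ → m≤n+o⇒m∸n≤o m (degree₀ G) (colours≤degree+compatible f))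

adjacent⇒≢ : ∀ {n} (G : Graph n) u v → adj G u v ≡ true → u ≢ v
adjacent⇒≢ G u .u adjacent refl = false≢true (trans (sym (irrefl G u)) adjacent)

module _ {n m : ℕ} {G : Graph n} (𝓗 : Cover G m) where

  isTransversalᵇ-from-edges : ∀ c → (∀ u v → adj G u v ≡ true → adjH 𝓗 u (c u) v (c v) ≡ false) →
    isTransversalᵇ (adjH 𝓗) c ≡ true
  isTransversalᵇ-from-edges c on-edges = isTransversalᵇ⁺ {R = adjH 𝓗} independent
    where
    independent : ∀ u v → adjH 𝓗 u (c u) v (c v) ≡ false
    independent u v with u ≟ v
    ... | yes refl = irreflH 𝓗 u (c u)
    ... | no u≢v with adj G u v in adjacent
    ...   | true  = on-edges u v adjacent
    ...   | false = nonEdge 𝓗 u v u≢v adjacent (c u) (c v)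

  numTransversals-edgeless : (∀ u v → adj G u v ≡ false) → numTransversals (adjH 𝓗) ≡ m ^ n
  numTransversals-edgeless no-edges = begin
    count (isTransversalᵇ (adjH 𝓗)) (colourings n m)
      ≡⟨ count-cong (λ c → isTransversalᵇ-from-edges c λ u v adjacent →
                       ⊥-elim (false≢true (trans (sym (no-edges u v)) adjacent))) (colourings n m) ⟩
    count (λ _ → true) (colourings n m)
      ≡⟨ count-allFuns-true (allFin m) n ⟩
    length (allFin m) ^ n
      ≡⟨ cong (_^ n) (length-tabulate (λ x → x)) ⟩
    m ^ n ∎
    where open ≡-Reasoning

module PermutationCover {n m : ℕ} (G : Graph n) (σ : Fin n → Fin n → Fin m → Fin m)
  (σ-sym : ∀ u v b → σ u v b ≡ σ v u b) (σ-involutive : ∀ u v b → σ u v (σ u v b) ≡ b) where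

  R : CoverAdj n m
  R u a v b = (u == v ∧ not (a == b)) ∨ (adj G u v ∧ a == σ u v b)

  ==σ-sym : ∀ u v a b → a == σ u v b ≡ b == σ v u a
  ==σ-sym u v a b with a ≟ σ u v b | b ≟ σ v u a
  ... | yes _ | yes _ = refl
  ... | no  _ | no  _ = refl
  ... | yes a≡σb | no b≢σa =
    ⊥-elim (b≢σa (trans (sym (σ-involutive u v b)) (trans (cong (σ u v) (sym a≡σb)) (σ-sym u v a))))
  ... | no a≢σb | yes b≡σa =
    ⊥-elim (a≢σb (trans (sym (σ-involutive v u a)) (trans (cong (σ v u) (sym b≡σa)) (sym (σ-sym u v b)))))

  R-edge : ∀ u v → adj G u v ≡ true → ∀ a b → R u a v b ≡ a == σ u v b
  R-edge u v adjacent a b rewrite ≢⇒==false (adjacent⇒≢ G u v adjacent) | adjacent = refl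

  R-sym : ∀ u a v b → R u a v b ≡ R v b u a
  R-sym u a v b = cong₂ _∨_ (cong₂ (λ x y → x ∧ not y) (==-sym u v) (==-sym a b))
                            (cong₂ _∧_ (Graph.sym G u v) (==σ-sym u v a b))

  R-irrefl : ∀ u a → R u a u a ≡ false
  R-irrefl u a rewrite ==-refl u | ==-refl a | irrefl G u = refl

  R-clique : ∀ u a b → a ≢ b → R u a u b ≡ true
  R-clique u a b a≢b rewrite ==-refl u | ≢⇒==false a≢b = refl

  R-nonEdge : ∀ u v → u ≢ v → adj G u v ≡ false → ∀ a b → R u a v b ≡ false
  R-nonEdge u v u≢v nonadjacent a b rewrite ≢⇒==false u≢v | nonadjacent = refl

  R-matching : ∀ u v → adj G u v ≡ true → ∀ a b b′ → R u a v b ≡ true → R u a v b′ ≡ true → b ≡ b′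
  R-matching u v adjacent a b b′ ab ab′ = begin
    b                     ≡⟨ sym (σ-involutive u v b) ⟩
    σ u v (σ u v b)       ≡⟨ cong (σ u v) (sym (==⇒≡ (trans (sym (R-edge u v adjacent a b)) ab))) ⟩
    σ u v a               ≡⟨ cong (σ u v) (==⇒≡ (trans (sym (R-edge u v adjacent a b′)) ab′)) ⟩
    σ u v (σ u v b′)      ≡⟨ σ-involutive u v b′ ⟩
    b′                    ∎
    where open ≡-Reasoning

  R-full : ∀ u v → adj G u v ≡ true → ∀ a → ∃ λ b → R u a v b ≡ true
  R-full u v adjacent a =
    σ u v a , trans (R-edge u v adjacent a (σ u v a)) (subst (λ z → a == z ≡ true) (sym (σ-involutive u v a)) (==-refl a))

  fullCover : FullCover G m
  fullCover = record
    { cover = record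
      { adjH = R ; symH = R-sym ; irreflH = R-irrefl ; clique = R-clique ; nonEdge = R-nonEdge ; matching = R-matching }
    ; full  = R-full
    }

  transversal⇒twisted-proper : ∀ c → isTransversalᵇ R c ≡ true → ∀ u v → adj G u v ≡ true → c u ≢ σ u v (c v)
  transversal⇒twisted-proper c transversal u v adjacent c≡σc = false≢true
    (trans (sym (isTransversalᵇ⁻ {R = R} transversal u v))
           (trans (R-edge u v adjacent (c u) (c v)) (subst (λ z → c u == z ≡ true) c≡σc (==-refl (c u)))))

  twisted-proper⇒transversal : ∀ c → (∀ u v → adj G u v ≡ true → c u ≢ σ u v (c v)) → isTransversalᵇ R c ≡ true
  twisted-proper⇒transversal c proper = isTransversalᵇ-from-edges (cover fullCover) c
    (λ u v adjacent → trans (R-edge u v adjacent (c u) (c v)) (≢⇒==false (proper u v adjacent)))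

module IdentityCover {n m : ℕ} (G : Graph n) where
  open PermutationCover {n} {m} G (λ _ _ b → b) (λ _ _ _ → refl) (λ _ _ _ → refl) public

  isTransversalᵇ≡isProperᵇ : ∀ c → isTransversalᵇ R c ≡ isProperᵇ G c
  isTransversalᵇ≡isProperᵇ c = sym (trans (all-allFin {n} _)
    (allFinᵇ-cong λ u → trans (all-allFin {n} _) (allFinᵇ-cong λ v → pointwise u v)))
    where
    pointwise : ∀ u v → (not (adj G u v) ∨ not (c u == c v)) ≡ not (R u (c u) v (c v))
    pointwise u v with u ≟ v
    ... | yes refl rewrite ==-refl (c u) | irrefl G u = refl
    ... | no _ with adj G u v
    ...   | true  = refl
    ...   | false = refl

  P≡numTransversals : P G m ≡ numTransversals R
  P≡numTransversals =
    trans (length-filterᵇ≡count _ (colourings n m)) (sym (count-cong isTransversalᵇ≡isProperᵇ (colourings n m)))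

-- The minimum defining P_DP(G, m) is attained: up to the choice of adjH, there are finitely many full covers.

FullCoverConditions : ∀ {n} → Graph n → (m : ℕ) → CoverAdj n m → Set
FullCoverConditions G m R =
    (∀ u a v b → R u a v b ≡ R v b u a)
  × (∀ u a → R u a u a ≡ false)
  × (∀ u a b → a ≢ b → R u a u b ≡ true)
  × (∀ u v → u ≢ v → adj G u v ≡ false → ∀ a b → R u a v b ≡ false)
  × (∀ u v → adj G u v ≡ true → ∀ a b b′ → R u a v b ≡ true → R u a v b′ ≡ true → b ≡ b′)
  × (∀ u v → adj G u v ≡ true → ∀ a → ∃ λ b → R u a v b ≡ true)

fullCoverConditions? : ∀ {n} (G : Graph n) (m : ℕ) (R : CoverAdj n m) → Dec (FullCoverConditions G m R)
fullCoverConditions? G m R =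
        all? (λ u → all? (λ a → all? (λ v → all? (λ b → R u a v b Bool.≟ R v b u a))))
  ×-dec all? (λ u → all? (λ a → R u a u a Bool.≟ false))
  ×-dec all? (λ u → all? (λ a → all? (λ b → ¬? (a ≟ b) →-dec (R u a u b Bool.≟ true))))
  ×-dec all? (λ u → all? (λ v → ¬? (u ≟ v) →-dec ((adj G u v Bool.≟ false) →-dec
          all? (λ a → all? (λ b → R u a v b Bool.≟ false)))))
  ×-dec all? (λ u → all? (λ v → (adj G u v Bool.≟ true) →-dec all? (λ a → all? (λ b → all? (λ b′ →
          (R u a v b Bool.≟ true) →-dec ((R u a v b′ Bool.≟ true) →-dec (b ≟ b′)))))))
  ×-dec all? (λ u → all? (λ v → (adj G u v Bool.≟ true) →-dec all? (λ a → any? (λ b → R u a v b Bool.≟ true))))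

module _ {n m : ℕ} {G : Graph n} where

  fromConditions : (R : CoverAdj n m) → FullCoverConditions G m R → FullCover G m
  fromConditions R (sym′ , irrefl′ , clique′ , nonEdge′ , matching′ , full′) = record
    { cover = record
      { adjH = R ; symH = sym′ ; irreflH = irrefl′ ; clique = clique′ ; nonEdge = nonEdge′ ; matching = matching′ }
    ; full  = full′ }

  toConditions : (𝓗 : FullCover G m) → FullCoverConditions G m (adjH (cover 𝓗))
  toConditions 𝓗 = symH (cover 𝓗) , irreflH (cover 𝓗) , clique (cover 𝓗) , nonEdge (cover 𝓗) , matching (cover 𝓗) , full 𝓗

  conditions-respect : (R R′ : CoverAdj n m) → (∀ u a v b → R u a v b ≡ R′ u a v b) →
    FullCoverConditions G m R → FullCoverConditions G m R′
  conditions-respect R R′ R≡R′ (sym′ , irrefl′ , clique′ , nonEdge′ , matching′ , full′) =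
      (λ u a v b → trans (sym (R≡R′ u a v b)) (trans (sym′ u a v b) (R≡R′ v b u a)))
    , (λ u a → trans (sym (R≡R′ u a u a)) (irrefl′ u a))
    , (λ u a b a≢b → trans (sym (R≡R′ u a u b)) (clique′ u a b a≢b))
    , (λ u v u≢v nonadjacent a b → trans (sym (R≡R′ u a v b)) (nonEdge′ u v u≢v nonadjacent a b))
    , (λ u v adjacent a b b′ ab ab′ → matching′ u v adjacent a b b′ (trans (R≡R′ u a v b) ab) (trans (R≡R′ u a v b′) ab′))
    , (λ u v adjacent a → proj₁ (full′ u v adjacent a) , trans (sym (R≡R′ u a v _)) (proj₂ (full′ u v adjacent a)))

  numHColorings-cong : (𝓗 𝓗′ : Cover G m) → (∀ u a v b → adjH 𝓗 u a v b ≡ adjH 𝓗′ u a v b) →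
    numHColorings 𝓗 ≡ numHColorings 𝓗′
  numHColorings-cong 𝓗 𝓗′ same = trans (length-filterᵇ≡count _ (subsets n m))
    (trans (count-cong (λ S → cong (_∧ (size S ≡ᵇ n)) (all-cong (λ u → all-cong (λ a → all-cong (λ v → all-cong (λ b →
      cong (λ z → not (S u a ∧ S v b ∧ z)) (same u a v b)) (allFin m)) (allFin n)) (allFin m)) (allFin n))) (subsets n m))
    (sym (length-filterᵇ≡count _ (subsets n m))))

  fullCoversAmong : List (CoverAdj n m) → List (FullCover G m)
  fullCoversAmong []       = []
  fullCoversAmong (R ∷ Rs) with fullCoverConditions? G m R
  ... | yes conditions = fromConditions R conditions ∷ fullCoversAmong Rs
  ... | no  _          = fullCoversAmong Rs

  fullCoversAmong-complete : ∀ {R} Rs → R ∈ Rs → FullCoverConditions G m R →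
    ∃ λ 𝓗 → 𝓗 ∈ fullCoversAmong Rs × adjH (cover 𝓗) ≡ R
  fullCoversAmong-complete (R ∷ Rs) (here refl) conditions with fullCoverConditions? G m R
  ... | yes conditions′ = fromConditions R conditions′ , here refl , refl
  ... | no  fails       = ⊥-elim (fails conditions)
  fullCoversAmong-complete (R′ ∷ Rs) (there R∈Rs) conditions with fullCoverConditions? G m R′
  ... | yes _ = let 𝓗 , 𝓗∈ , adjH≡ = fullCoversAmong-complete Rs R∈Rs conditions in 𝓗 , there 𝓗∈ , adjH≡
  ... | no  _ = fullCoversAmong-complete Rs R∈Rs conditions

allCoverAdj : (n m : ℕ) → List (CoverAdj n m)
allCoverAdj n m = allFuns n (allFuns m (allFuns n (allFuns m (true ∷ false ∷ []))))

allCoverAdj-complete : ∀ {n m} (R : CoverAdj n m) → ∃ λ R′ → R′ ∈ allCoverAdj n m × (∀ u a v b → R′ u a v b ≡ R u a v b)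
allCoverAdj-complete {n} {m} R with count-positive (λ R′ → pointwiseᵇ (pointwiseᵇ (pointwiseᵇ (pointwiseᵇ _==ᴮ_))) R′ R)
  (allCoverAdj n m) (≤-reflexive (sym unique))
  where
  unique = count-allFuns-pointwise≡1 _ _ (λ y → count-allFuns-pointwise≡1 _ _ (λ y′ → count-allFuns-pointwise≡1 _ _
    (λ y″ → count-allFuns-pointwise≡1 _==ᴮ_ (true ∷ false ∷ []) count-==ᴮ m y″) n y′) m y) n R
... | R′ , R′∈ , R′≈R = R′ , R′∈ , λ u a v b → ==ᴮ⇒≡ (allFinᵇ⁻ (allFinᵇ⁻ (allFinᵇ⁻ (allFinᵇ⁻ R′≈R u) a) v) b)

PDP-exists : ∀ {n m} (G : Graph n) → FullCover G m → Σ ℕ (IsPDP G m)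
PDP-exists {n} {m} G 𝓗₀ = numH minimiser , (minimiser , refl) , minimal
  where
  numH : FullCover G m → ℕ
  numH 𝓗 = numHColorings (cover 𝓗)
  candidates = fullCoversAmong {G = G} (allCoverAdj n m)
  minimiser = argmin numH 𝓗₀ candidates
  minimal : (𝓗 : FullCover G m) → numH minimiser ≤ numH 𝓗
  minimal 𝓗 with allCoverAdj-complete (adjH (cover 𝓗))
  ... | R , R∈ , R≡ with fullCoversAmong-complete (allCoverAdj n m) R∈
                          (conditions-respect {G = G} (adjH (cover 𝓗)) R (λ u a v b → sym (R≡ u a v b)) (toConditions 𝓗))
  ...   | 𝓗′ , 𝓗′∈ , refl = ≤-trans (All.lookup (f[argmin]≤f[xs] 𝓗₀ candidates) 𝓗′∈)
                                    (≤-reflexive (numHColorings-cong (cover 𝓗′) (cover 𝓗) R≡))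

-- The graphs Γ k

edgeList : List (ℕ × ℕ)
edgeList = (0 , 1) ∷ (0 , 2) ∷ (1 , 4) ∷ (1 , 5) ∷ (2 , 3) ∷ (2 , 4) ∷ (3 , 4) ∷ (3 , 5) ∷ (4 , 5) ∷ []

matches : ℕ → ℕ → ℕ × ℕ → Bool
matches i j (a , b) = (a ≡ᵇ i) ∧ (b ≡ᵇ j)

listed : ℕ → ℕ → Bool
listed i j = any (matches i j) edgeList

listed-irrefl : ∀ i → listed i i ≡ false
listed-irrefl 0 = refl
listed-irrefl 1 = refl
listed-irrefl 2 = refl
listed-irrefl 3 = refl
listed-irrefl 4 = refl
listed-irrefl 5 = refl
listed-irrefl (suc (suc (suc (suc (suc (suc i)))))) = refl

Γ : (k : ℕ) → Graph (6 + k)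
Γ k = record
  { adj    = λ u v → listed (toℕ u) (toℕ v) ∨ listed (toℕ v) (toℕ u)
  ; sym    = λ u v → Bool.∨-comm (listed (toℕ u) (toℕ v)) _
  ; irrefl = λ v → cong₂ _∨_ (listed-irrefl (toℕ v)) (listed-irrefl (toℕ v))
  }

data Edge {k : ℕ} : Fin (6 + k) → Fin (6 + k) → Set where
  e01 : Edge 0F 1F
  e02 : Edge 0F 2F
  e14 : Edge 1F 4F
  e15 : Edge 1F 5F
  e23 : Edge 2F 3F
  e24 : Edge 2F 4F
  e34 : Edge 3F 4F
  e35 : Edge 3F 5F
  e45 : Edge 4F 5F

edge-at : ∀ {k} {x y u v : Fin (6 + k)} → Edge x y → T (matches (toℕ u) (toℕ v) (toℕ x , toℕ y)) → Edge u v
edge-at e xy≡uv with Equivalence.to Bool.T-∧ xy≡uv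
... | x≡u , y≡v = subst₂ Edge (toℕ-injective (≡ᵇ⇒≡ _ _ x≡u)) (toℕ-injective (≡ᵇ⇒≡ _ _ y≡v)) e

edge-from-listed : ∀ {k} (u v : Fin (6 + k)) → T (listed (toℕ u) (toℕ v)) → Edge u v
edge-from-listed u v uv with any⁻ (matches (toℕ u) (toℕ v)) edgeList uv
... | here p                                                                = edge-at e01 p
... | there (here p)                                                        = edge-at e02 p
... | there (there (here p))                                                = edge-at e14 p
... | there (there (there (here p)))                                        = edge-at e15 p
... | there (there (there (there (here p))))                                = edge-at e23 p
... | there (there (there (there (there (here p)))))                        = edge-at e24 p
... | there (there (there (there (there (there (here p))))))                = edge-at e34 p
... | there (there (there (there (there (there (there (here p)))))))        = edge-at e35 p
... | there (there (there (there (there (there (there (there (here p)))))))) = edge-at e45 p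

edge-view : ∀ {k} (u v : Fin (6 + k)) → adj (Γ k) u v ≡ true → Edge u v ⊎ Edge v u
edge-view u v adjacent with Equivalence.to Bool.T-∨ (≡true⇒T adjacent)
... | inj₁ uv = inj₁ (edge-from-listed u v uv)
... | inj₂ vu = inj₂ (edge-from-listed v u vu)

peel-≥ : ∀ {n} {G : Graph (suc n)} (𝓗 : Cover G 3) d → degree₀ G ≡ d →
  (3 ∸ d) * numTransversals (adjH (tailCover 𝓗)) ≤ numTransversals (adjH 𝓗)
peel-≥ 𝓗 d refl = PeelLowerBound.numTransversals-tail-≥ 𝓗

peel-≥-deg2 : ∀ {n} {G : Graph (suc n)} (𝓗 : Cover G 3) → degree₀ G ≡ 2 →
  numTransversals (adjH (tailCover 𝓗)) ≤ numTransversals (adjH 𝓗)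
peel-≥-deg2 𝓗 deg≡2 = ≤-trans (≤-reflexive (sym (*-identityˡ _))) (peel-≥ 𝓗 2 deg≡2)

numTransversals-Γ-≥ : ∀ k (𝓗 : Cover (Γ k) 3) → 6 * 3 ^ k ≤ numTransversals (adjH 𝓗)
numTransversals-Γ-≥ k 𝓗₀ = begin
  6 * 3 ^ k       ≡⟨ *-assoc 2 3 (3 ^ k) ⟩
  2 * (3 * 3 ^ k) ≡⟨ cong (λ t → 2 * (3 * t)) (sym (numTransversals-edgeless 𝓗₆ (λ u v → refl))) ⟩
  2 * (3 * # 𝓗₆)  ≤⟨ *-monoʳ-≤ 2 (peel-≥ 𝓗₅ 0 (∑Fin-zero k)) ⟩
  2 * # 𝓗₅        ≤⟨ peel-≥ 𝓗₄ 1 (cong suc (∑Fin-zero k)) ⟩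
  # 𝓗₄            ≤⟨ peel-≥-deg2 𝓗₃ (cong (2 +_) (∑Fin-zero k)) ⟩
  # 𝓗₃            ≤⟨ peel-≥-deg2 𝓗₂ (cong (2 +_) (∑Fin-zero k)) ⟩
  # 𝓗₂            ≤⟨ peel-≥-deg2 𝓗₁ (cong (2 +_) (∑Fin-zero k)) ⟩
  # 𝓗₁            ≤⟨ peel-≥-deg2 𝓗₀ (cong (2 +_) (∑Fin-zero k)) ⟩
  # 𝓗₀            ∎
  where
  open ≤-Reasoning
  # : ∀ {n} {G : Graph n} → Cover G 3 → ℕ
  # 𝓗 = numTransversals (adjH 𝓗)
  𝓗₁ = tailCover 𝓗₀
  𝓗₂ = tailCover 𝓗₁
  𝓗₃ = tailCover 𝓗₂
  𝓗₄ = tailCover 𝓗₃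
  𝓗₅ = tailCover 𝓗₄
  𝓗₆ = tailCover 𝓗₅

Γ-DPColorable : ∀ k → DPColorable (Γ k) 3
Γ-DPColorable k 𝓗 with count-positive (isTransversalᵇ (adjH 𝓗)) (colourings (6 + k) 3)
                         (≤-trans (≤-trans (m^n>0 3 k) (m≤n*m (3 ^ k) 6)) (numTransversals-Γ-≥ k 𝓗))
... | c , _ , transversal = graphOf c , ≡true⇒T (graphOf-HColoring 𝓗 c transversal)

triangle-needs-three-colours : ∀ {j} → j < 3 → (a b c : Fin j) → a ≢ b → a ≢ c → b ≢ c → ⊥
triangle-needs-three-colours {suc (suc (suc _))} (s≤s (s≤s (s≤s ())))
triangle-needs-three-colours _ 0F 0F _  a≢b _   _   = a≢b refl
triangle-needs-three-colours _ 0F 1F 0F _   a≢c _   = a≢c refl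
triangle-needs-three-colours _ 0F 1F 1F _   _   b≢c = b≢c refl
triangle-needs-three-colours _ 1F 0F 0F _   _   b≢c = b≢c refl
triangle-needs-three-colours _ 1F 0F 1F _   a≢c _   = a≢c refl
triangle-needs-three-colours _ 1F 1F _  a≢b _   _   = a≢b refl

Γ-not-DPColorable : ∀ k j → 1 ≤ j → j < 3 → ¬ DPColorable (Γ k) j
Γ-not-DPColorable k (suc j) _ j<3 colourable with colourable (cover (IdentityCover.fullCover {m = suc j} (Γ k)))
... | S , hcol = triangle-needs-three-colours j<3 (c 3F) (c 4F) (c 5F)
                   (proper 3F 4F refl) (proper 3F 5F refl) (proper 4F 5F refl)
  where
  module I = IdentityCover {m = suc j} (Γ k)
  c = choice S
  proper : ∀ u v → adj (Γ k) u v ≡ true → c u ≢ c v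
  proper = I.transversal⇒twisted-proper c (FibresOfHColoring.choice-transversal (cover I.fullCover) {S} (T⇒≡true hcol))

Γ-χDP : ∀ k → IsχDP (Γ k) 3
Γ-χDP k = s≤s z≤n , Γ-DPColorable k , Γ-not-DPColorable k

avoiding-one-in-Fin3 : ∀ (y : Fin 3) → count (λ x → not (x == y)) (allFin 3) ≤ 2
avoiding-one-in-Fin3 = from-yes (all? λ (y : Fin 3) → count (λ x → not (x == y)) (allFin 3) ≤? 2)

avoiding-two-in-Fin3 : ∀ (y z : Fin 3) → y ≢ z → count (λ x → not (x == y) ∧ not (x == z)) (allFin 3) ≤ 1
avoiding-two-in-Fin3 = from-yes (all? λ (y : Fin 3) → all? λ (z : Fin 3) →
  ¬? (y ≟ z) →-dec (count (λ x → not (x == y) ∧ not (x == z)) (allFin 3) ≤? 1))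

third-colour-in-Fin3 : ∀ (a b c x : Fin 3) → a ≢ b → a ≢ c → b ≢ c → x ≢ b → x ≢ c → x ≡ a
third-colour-in-Fin3 = from-yes (all? λ (a : Fin 3) → all? λ (b : Fin 3) → all? λ (c : Fin 3) → all? λ (x : Fin 3) →
  ¬? (a ≟ b) →-dec ¬? (a ≟ c) →-dec ¬? (b ≟ c) →-dec ¬? (x ≟ b) →-dec ¬? (x ≟ c) →-dec (x ≟ a))

IdentityOnEdges : ∀ {n m} {G : Graph n} → Cover G m → Set
IdentityOnEdges {G = G} 𝓗 = ∀ u v → adj G u v ≡ true → ∀ a b → adjH 𝓗 u a v b ≡ a == b

module PeelUpperBound {n : ℕ} {G : Graph (suc n)} (𝓗 : Cover G 3) (identity : IdentityOnEdges 𝓗) where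

  compatible⇒avoids : ∀ x f → compatible (adjH 𝓗) x f ≡ true → ∀ v → adj G zero (suc v) ≡ true → x == f v ≡ false
  compatible⇒avoids x f compat v adjacent = trans (sym (identity zero (suc v) adjacent x (f v)))
    (not-true⁻ (allFinᵇ⁻ (Bool.∧-conicalˡ _ _ (Bool.∧-conicalʳ (not (adjH 𝓗 zero x zero x)) _ compat)) v))

  tail-transversal⇒proper : ∀ f → isTransversalᵇ (restrict (adjH 𝓗)) f ≡ true →
    ∀ u v → adj G (suc u) (suc v) ≡ true → f u ≢ f v
  tail-transversal⇒proper f transversal u v adjacent fu≡fv = false≢true (trans
    (sym (isTransversalᵇ⁻ {R = restrict (adjH 𝓗)} transversal u v))
    (trans (identity (suc u) (suc v) adjacent (f u) (f v)) (subst (λ z → f u == z ≡ true) fu≡fv (==-refl (f u)))))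

  compatible≤1 : ∀ f v w → adj G zero (suc v) ≡ true → adj G zero (suc w) ≡ true → f v ≢ f w →
    count (λ x → compatible (adjH 𝓗) x f) (allFin 3) ≤ 1
  compatible≤1 f v w adjacent-v adjacent-w fv≢fw = ≤-trans
    (count-mono (λ x compat → cong₂ _∧_ (cong not (compatible⇒avoids x f compat v adjacent-v))
                                        (cong not (compatible⇒avoids x f compat w adjacent-w))) (allFin 3))
    (avoiding-two-in-Fin3 (f v) (f w) fv≢fw)

  compatible≤2 : ∀ f v → adj G zero (suc v) ≡ true → count (λ x → compatible (adjH 𝓗) x f) (allFin 3) ≤ 2
  compatible≤2 f v adjacent = ≤-trans
    (count-mono (λ x compat → cong not (compatible⇒avoids x f compat v adjacent)) (allFin 3))
    (avoiding-one-in-Fin3 (f v))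

  numTransversals-≤-distinct-neighbours : ∀ v w → adj G zero (suc v) ≡ true → adj G zero (suc w) ≡ true →
    (∀ f → isTransversalᵇ (restrict (adjH 𝓗)) f ≡ true → f v ≢ f w) →
    numTransversals (adjH 𝓗) ≤ numTransversals (adjH (tailCover 𝓗))
  numTransversals-≤-distinct-neighbours v w adjacent-v adjacent-w distinct = ≤-trans
    (numTransversals-∷-≤ (adjH 𝓗) 1 (λ f t → compatible≤1 f v w adjacent-v adjacent-w (distinct f t)))
    (≤-reflexive (*-identityˡ _))

  numTransversals-≤-adjacent-neighbours : ∀ v w → adj G zero (suc v) ≡ true → adj G zero (suc w) ≡ true →
    adj G (suc v) (suc w) ≡ true → numTransversals (adjH 𝓗) ≤ numTransversals (adjH (tailCover 𝓗))
  numTransversals-≤-adjacent-neighbours v w adjacent-v adjacent-w adjacent-vw =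
    numTransversals-≤-distinct-neighbours v w adjacent-v adjacent-w (λ f t → tail-transversal⇒proper f t v w adjacent-vw)

  numTransversals-≤-one-neighbour : ∀ v → adj G zero (suc v) ≡ true →
    numTransversals (adjH 𝓗) ≤ 2 * numTransversals (adjH (tailCover 𝓗))
  numTransversals-≤-one-neighbour v adjacent = numTransversals-∷-≤ (adjH 𝓗) 2 (λ f _ → compatible≤2 f v adjacent)

  numTransversals-≤-three : numTransversals (adjH 𝓗) ≤ 3 * numTransversals (adjH (tailCover 𝓗))
  numTransversals-≤-three = numTransversals-∷-≤ (adjH 𝓗) 3 (λ f _ →
    count-mono {p = λ x → compatible (adjH 𝓗) x f} {q = λ _ → true} (λ _ _ → refl) (allFin 3))

  identity-tail : IdentityOnEdges (tailCover 𝓗)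
  identity-tail u v = identity (suc u) (suc v)

-- f i is the colour of vertex i + 1; the triangle 3 4 5 forces colour(1) = colour(3) and colour(2) = colour(5).
Γ-neighbours-of-0-differ : ∀ k (𝓗 : Cover (Γ k) 3) → IdentityOnEdges 𝓗 →
  ∀ f → isTransversalᵇ (restrict (adjH 𝓗)) f ≡ true → f 0F ≢ f 1F
Γ-neighbours-of-0-differ k 𝓗 identity f transversal f1≡f2 = proper 2F 4F refl (trans (sym f1≡f3) (trans f1≡f2 f2≡f5))
  where
  proper = PeelUpperBound.tail-transversal⇒proper 𝓗 identity f transversal
  f1≡f3 : f 0F ≡ f 2F
  f1≡f3 = third-colour-in-Fin3 (f 2F) (f 3F) (f 4F) (f 0F)
    (proper 2F 3F refl) (proper 2F 4F refl) (proper 3F 4F refl) (proper 0F 3F refl) (proper 0F 4F refl)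
  f2≡f5 : f 1F ≡ f 4F
  f2≡f5 = third-colour-in-Fin3 (f 4F) (f 2F) (f 3F) (f 1F)
    (≢-sym (proper 2F 4F refl)) (≢-sym (proper 3F 4F refl)) (proper 2F 3F refl) (proper 1F 2F refl) (proper 1F 3F refl)

-- In 𝓘ᵢ, vertex j of Γ k is numbered j ∸ i.
P-Γ-≤ : ∀ k → P (Γ k) 3 ≤ 6 * 3 ^ k
P-Γ-≤ k = begin
  P (Γ k) 3        ≡⟨ I.P≡numTransversals ⟩
  # 𝓘₀             ≤⟨ U₀.numTransversals-≤-distinct-neighbours 0F 1F refl refl (Γ-neighbours-of-0-differ k 𝓘₀ I.R-edge) ⟩
  # 𝓘₁             ≤⟨ U₁.numTransversals-≤-adjacent-neighbours 2F 3F refl refl refl ⟩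
  # 𝓘₂             ≤⟨ U₂.numTransversals-≤-adjacent-neighbours 0F 1F refl refl refl ⟩
  # 𝓘₃             ≤⟨ U₃.numTransversals-≤-adjacent-neighbours 0F 1F refl refl refl ⟩
  # 𝓘₄             ≤⟨ U₄.numTransversals-≤-one-neighbour 0F refl ⟩
  2 * # 𝓘₅         ≤⟨ *-monoʳ-≤ 2 U₅.numTransversals-≤-three ⟩
  2 * (3 * # 𝓘₆)   ≡⟨ cong (λ t → 2 * (3 * t)) (numTransversals-edgeless 𝓘₆ (λ u v → refl)) ⟩
  2 * (3 * 3 ^ k)  ≡⟨ sym (*-assoc 2 3 (3 ^ k)) ⟩
  6 * 3 ^ k        ∎
  where
  open ≤-Reasoning
  module I = IdentityCover {m = 3} (Γ k)
  # : ∀ {n} {G : Graph n} → Cover G 3 → ℕ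
  # 𝓗 = numTransversals (adjH 𝓗)
  𝓘₀ = cover I.fullCover
  𝓘₁ = tailCover 𝓘₀
  𝓘₂ = tailCover 𝓘₁
  𝓘₃ = tailCover 𝓘₂
  𝓘₄ = tailCover 𝓘₃
  𝓘₅ = tailCover 𝓘₄
  𝓘₆ = tailCover 𝓘₅
  module U₀ = PeelUpperBound 𝓘₀ I.R-edge
  module U₁ = PeelUpperBound 𝓘₁ U₀.identity-tail
  module U₂ = PeelUpperBound 𝓘₂ U₁.identity-tail
  module U₃ = PeelUpperBound 𝓘₃ U₂.identity-tail
  module U₄ = PeelUpperBound 𝓘₄ U₃.identity-tail
  module U₅ = PeelUpperBound 𝓘₅ U₄.identity-tail

Γ-PDP-3 : ∀ k → IsPDP (Γ k) 3 (P (Γ k) 3)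
Γ-PDP-3 k = (I.fullCover , trans (numHColorings≡numTransversals (cover I.fullCover)) (sym I.P≡numTransversals))
           , λ 𝓗 → ≤-trans (P-Γ-≤ k) (≤-trans (numTransversals-Γ-≥ k (cover 𝓗))
                                               (≤-reflexive (sym (numHColorings≡numTransversals (cover 𝓗)))))
  where module I = IdentityCover {m = 3} (Γ k)

-- The edge 0 2 is twisted by π = (0 1). A twisted colouring x fails to be proper only when
-- x₀ = x₂ ∈ {0, 1}; untwist then recolours some of the vertices 0, 1, 3, 4, 5 to get a proper
-- colouring from which retwist recovers x. The colouring missed below is not of this form.
module Untwisting (M : ℕ) where

  Colour = Fin (5 + M)

  π : Colour → Colour
  π 0F            = 1F
  π 1F            = 0F
  π (suc (suc x)) = suc (suc x)

  π-involutive : ∀ x → π (π x) ≡ x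
  π-involutive 0F            = refl
  π-involutive 1F            = refl
  π-involutive (suc (suc x)) = refl

  fresh : Colour → Colour
  fresh b = if b == 2F then 3F else 2F

  fresh≢moved : ∀ b x → x ≢ π x → fresh b ≢ x
  fresh≢moved b (suc (suc x)) x≢πx _ = x≢πx refl
  fresh≢moved b 0F _ with b == 2F
  ... | true  = λ ()
  ... | false = λ ()
  fresh≢moved b 1F _ with b == 2F
  ... | true  = λ ()
  ... | false = λ ()

  fresh≢π : ∀ b x → x ≢ π x → fresh b ≢ π x
  fresh≢π b x x≢πx = fresh≢moved b (π x) (λ πx≡ππx → x≢πx (sym (trans πx≡ππx (π-involutive x))))

  fresh≢ : ∀ b → fresh b ≢ b
  fresh≢ b with b ≟ 2F
  ... | yes refl = λ ()
  ... | no b≢2   = λ fresh≡b → b≢2 (sym fresh≡b)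

  record Six : Set where
    constructor six
    field x₀ x₁ x₂ x₃ x₄ x₅ : Colour

  record Respects (_≁_ : Colour → Colour → Set) (t : Six) : Set where
    open Six t
    field
      x₀≢x₁ : x₀ ≢ x₁
      x₀≁x₂ : x₀ ≁ x₂
      x₁≢x₄ : x₁ ≢ x₄
      x₁≢x₅ : x₁ ≢ x₅
      x₂≢x₃ : x₂ ≢ x₃
      x₂≢x₄ : x₂ ≢ x₄
      x₃≢x₄ : x₃ ≢ x₄
      x₃≢x₅ : x₃ ≢ x₅
      x₄≢x₅ : x₄ ≢ x₅

  Twisted Proper : Six → Set
  Twisted = Respects (λ a b → a ≢ π b)
  Proper  = Respects _≢_

  πx≢x : ∀ {x x₁ x₃ x₄ x₅} → Twisted (six x x₁ x x₃ x₄ x₅) → π x ≢ x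
  πx≢x twisted πx≡x = Respects.x₀≁x₂ twisted (sym πx≡x)

  untwist : Six → Six
  untwist (six x₀ x₁ x₂ x₃ x₄ x₅) =
    if x₀ == x₂ then
      (if x₁ == π x₂ then
        (if x₅ == x₂ then
          (if x₃ == π x₂ then six (π x₂) x₂ x₂ (fresh x₄) (π x₂) x₄
                          else six (π x₂) x₂ x₂ x₃ x₄ (π x₂))
          else six (π x₂) x₂ x₂ x₃ x₄ x₅)
        else six (π x₂) x₁ x₂ x₃ x₄ x₅)
      else six x₀ x₁ x₂ x₃ x₄ x₅

  retwist : Six → Six
  retwist (six x₀ x₁ x₂ x₃ x₄ x₅) =
    if x₀ == π x₂ ∧ not (x₀ == x₂) then
      (if x₁ == x₂ then
        (if x₅ == π x₂ then six x₂ (π x₂) x₂ x₃ x₄ x₂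
         else if x₄ == π x₂ then six x₂ (π x₂) x₂ (π x₂) x₅ x₂
         else six x₂ (π x₂) x₂ x₃ x₄ x₅)
        else six x₂ x₁ x₂ x₃ x₄ x₅)
      else six x₀ x₁ x₂ x₃ x₄ x₅

  data UntwistCase : Six → Set where
    unchanged : ∀ {x₀ x₁ x₂ x₃ x₄ x₅} → x₀ ≢ x₂ → UntwistCase (six x₀ x₁ x₂ x₃ x₄ x₅)
    move₀     : ∀ {x x₁ x₃ x₄ x₅} → x₁ ≢ π x → UntwistCase (six x x₁ x x₃ x₄ x₅)
    move₀₁    : ∀ {x x₃ x₄ x₅} → x₅ ≢ x → UntwistCase (six x (π x) x x₃ x₄ x₅)
    move₀₁₅   : ∀ {x x₃ x₄} → x₃ ≢ π x → UntwistCase (six x (π x) x x₃ x₄ x)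
    move₀₁₃₄₅ : ∀ {x x₄} → UntwistCase (six x (π x) x (π x) x₄ x)

  untwistCase : ∀ t → UntwistCase t
  untwistCase (six x₀ x₁ x₂ x₃ x₄ x₅) with x₀ ≟ x₂
  ... | no x₀≢x₂ = unchanged x₀≢x₂
  ... | yes refl with x₁ ≟ π x₀
  ...   | no x₁≢πx = move₀ x₁≢πx
  ...   | yes refl with x₅ ≟ x₀
  ...     | no x₅≢x = move₀₁ x₅≢x
  ...     | yes refl with x₃ ≟ π x₀
  ...       | no x₃≢πx = move₀₁₅ x₃≢πx
  ...       | yes refl = move₀₁₃₄₅

  untwist-unchanged : ∀ {x₀ x₁ x₂ x₃ x₄ x₅} → x₀ ≢ x₂ → untwist (six x₀ x₁ x₂ x₃ x₄ x₅) ≡ six x₀ x₁ x₂ x₃ x₄ x₅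
  untwist-unchanged x₀≢x₂ rewrite ≢⇒==false x₀≢x₂ = refl

  untwist-move₀ : ∀ {x x₁ x₃ x₄ x₅} → x₁ ≢ π x → untwist (six x x₁ x x₃ x₄ x₅) ≡ six (π x) x₁ x x₃ x₄ x₅
  untwist-move₀ {x} x₁≢πx rewrite ==-refl x | ≢⇒==false x₁≢πx = refl

  untwist-move₀₁ : ∀ {x x₃ x₄ x₅} → x₅ ≢ x → untwist (six x (π x) x x₃ x₄ x₅) ≡ six (π x) x x x₃ x₄ x₅
  untwist-move₀₁ {x} x₅≢x rewrite ==-refl x | ==-refl (π x) | ≢⇒==false x₅≢x = refl

  untwist-move₀₁₅ : ∀ {x x₃ x₄} → x₃ ≢ π x → untwist (six x (π x) x x₃ x₄ x) ≡ six (π x) x x x₃ x₄ (π x)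
  untwist-move₀₁₅ {x} x₃≢πx rewrite ==-refl x | ==-refl (π x) | ≢⇒==false x₃≢πx = refl

  untwist-move₀₁₃₄₅ : ∀ {x x₄} → untwist (six x (π x) x (π x) x₄ x) ≡ six (π x) x x (fresh x₄) (π x) x₄
  untwist-move₀₁₃₄₅ {x} rewrite ==-refl x | ==-refl (π x) = refl

  retwist-unchanged : ∀ {x₀ x₁ x₂ x₃ x₄ x₅} → x₀ ≢ π x₂ → retwist (six x₀ x₁ x₂ x₃ x₄ x₅) ≡ six x₀ x₁ x₂ x₃ x₄ x₅
  retwist-unchanged x₀≢πx₂ rewrite ≢⇒==false x₀≢πx₂ = refl

  retwist-move₀ : ∀ {x x₁ x₃ x₄ x₅} → π x ≢ x → x₁ ≢ x → retwist (six (π x) x₁ x x₃ x₄ x₅) ≡ six x x₁ x x₃ x₄ x₅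
  retwist-move₀ {x} πx≢x x₁≢x rewrite ==-refl (π x) | ≢⇒==false πx≢x | ≢⇒==false x₁≢x = refl

  retwist-move₀₁ : ∀ {x x₃ x₄ x₅} → π x ≢ x → x₅ ≢ π x → x₄ ≢ π x →
    retwist (six (π x) x x x₃ x₄ x₅) ≡ six x (π x) x x₃ x₄ x₅
  retwist-move₀₁ {x} πx≢x x₅≢πx x₄≢πx
    rewrite ==-refl (π x) | ≢⇒==false πx≢x | ==-refl x | ≢⇒==false x₅≢πx | ≢⇒==false x₄≢πx = refl

  retwist-move₀₁₅ : ∀ {x x₃ x₄} → π x ≢ x → retwist (six (π x) x x x₃ x₄ (π x)) ≡ six x (π x) x x₃ x₄ x
  retwist-move₀₁₅ {x} πx≢x rewrite ==-refl (π x) | ≢⇒==false πx≢x | ==-refl x = refl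

  retwist-move₀₁₃₄₅ : ∀ {x x₃ x₅} → π x ≢ x → x₅ ≢ π x → retwist (six (π x) x x x₃ (π x) x₅) ≡ six x (π x) x (π x) x₅ x
  retwist-move₀₁₃₄₅ {x} πx≢x x₅≢πx rewrite ==-refl (π x) | ≢⇒==false πx≢x | ==-refl x | ≢⇒==false x₅≢πx = refl

  untwist-proper : ∀ t → Twisted t → Proper (untwist t)
  untwist-proper t twisted with untwistCase t
  untwist-proper _ twisted | unchanged x₀≢x₂ = subst Proper (sym (untwist-unchanged x₀≢x₂)) record
    { x₀≢x₁ = x₀≢x₁ ; x₀≁x₂ = x₀≢x₂ ; x₁≢x₄ = x₁≢x₄ ; x₁≢x₅ = x₁≢x₅ ; x₂≢x₃ = x₂≢x₃
    ; x₂≢x₄ = x₂≢x₄ ; x₃≢x₄ = x₃≢x₄ ; x₃≢x₅ = x₃≢x₅ ; x₄≢x₅ = x₄≢x₅ }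
    where open Respects twisted
  untwist-proper _ twisted | move₀ x₁≢πx = subst Proper (sym (untwist-move₀ x₁≢πx)) record
    { x₀≢x₁ = ≢-sym x₁≢πx ; x₀≁x₂ = πx≢x twisted ; x₁≢x₄ = x₁≢x₄ ; x₁≢x₅ = x₁≢x₅ ; x₂≢x₃ = x₂≢x₃
    ; x₂≢x₄ = x₂≢x₄ ; x₃≢x₄ = x₃≢x₄ ; x₃≢x₅ = x₃≢x₅ ; x₄≢x₅ = x₄≢x₅ }
    where open Respects twisted
  untwist-proper _ twisted | move₀₁ x₅≢x = subst Proper (sym (untwist-move₀₁ x₅≢x)) record
    { x₀≢x₁ = πx≢x twisted ; x₀≁x₂ = πx≢x twisted ; x₁≢x₄ = x₂≢x₄ ; x₁≢x₅ = ≢-sym x₅≢x ; x₂≢x₃ = x₂≢x₃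
    ; x₂≢x₄ = x₂≢x₄ ; x₃≢x₄ = x₃≢x₄ ; x₃≢x₅ = x₃≢x₅ ; x₄≢x₅ = x₄≢x₅ }
    where open Respects twisted
  untwist-proper _ twisted | move₀₁₅ x₃≢πx = subst Proper (sym (untwist-move₀₁₅ x₃≢πx)) record
    { x₀≢x₁ = πx≢x twisted ; x₀≁x₂ = πx≢x twisted ; x₁≢x₄ = x₂≢x₄ ; x₁≢x₅ = x₀≁x₂ ; x₂≢x₃ = x₂≢x₃
    ; x₂≢x₄ = x₂≢x₄ ; x₃≢x₄ = x₃≢x₄ ; x₃≢x₅ = x₃≢πx ; x₄≢x₅ = ≢-sym x₁≢x₄ }
    where open Respects twisted
  untwist-proper (six x _ _ _ x₄ _) twisted | move₀₁₃₄₅ = subst Proper (sym (untwist-move₀₁₃₄₅ {x} {x₄})) record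
    { x₀≢x₁ = πx≢x twisted ; x₀≁x₂ = πx≢x twisted ; x₁≢x₄ = x₀≁x₂ ; x₁≢x₅ = x₂≢x₄
    ; x₂≢x₃ = ≢-sym (fresh≢moved x₄ x x₀≁x₂) ; x₂≢x₄ = x₀≁x₂ ; x₃≢x₄ = fresh≢π x₄ x x₀≁x₂ ; x₃≢x₅ = fresh≢ x₄
    ; x₄≢x₅ = x₁≢x₄ }
    where open Respects twisted

  retwist∘untwist : ∀ t → Twisted t → retwist (untwist t) ≡ t
  retwist∘untwist t twisted with untwistCase t
  ... | unchanged x₀≢x₂ = trans (cong retwist (untwist-unchanged x₀≢x₂)) (retwist-unchanged (Respects.x₀≁x₂ twisted))
  ... | move₀ x₁≢πx = trans (cong retwist (untwist-move₀ x₁≢πx))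
    (retwist-move₀ (πx≢x twisted) (≢-sym (Respects.x₀≢x₁ twisted)))
  ... | move₀₁ x₅≢x = trans (cong retwist (untwist-move₀₁ x₅≢x))
    (retwist-move₀₁ (πx≢x twisted) (≢-sym (Respects.x₁≢x₅ twisted)) (≢-sym (Respects.x₁≢x₄ twisted)))
  ... | move₀₁₅ x₃≢πx = trans (cong retwist (untwist-move₀₁₅ x₃≢πx)) (retwist-move₀₁₅ (πx≢x twisted))
  retwist∘untwist (six x _ _ _ x₄ _) twisted | move₀₁₃₄₅ = trans (cong retwist (untwist-move₀₁₃₄₅ {x} {x₄}))
    (retwist-move₀₁₃₄₅ (πx≢x twisted) (≢-sym (Respects.x₁≢x₄ twisted)))

twistedPair : ℕ → ℕ → Bool
twistedPair i j = matches i j (0 , 2) ∨ matches j i (0 , 2)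

module TwistedCover (k M : ℕ) where
  open Untwisting M

  σ : Fin (6 + k) → Fin (6 + k) → Colour → Colour
  σ u v b = if twistedPair (toℕ u) (toℕ v) then π b else b

  σ-sym : ∀ u v b → σ u v b ≡ σ v u b
  σ-sym u v b rewrite Bool.∨-comm (matches (toℕ u) (toℕ v) (0 , 2)) (matches (toℕ v) (toℕ u) (0 , 2)) = refl

  σ-involutive : ∀ u v b → σ u v (σ u v b) ≡ b
  σ-involutive u v b with twistedPair (toℕ u) (toℕ v)
  ... | true  = π-involutive b
  ... | false = refl

  module Twist = PermutationCover (Γ k) σ σ-sym σ-involutive
  module Ident = IdentityCover {m = 5 + M} (Γ k)

  sixOf : (Fin (6 + k) → Colour) → Six
  sixOf c = six (c 0F) (c 1F) (c 2F) (c 3F) (c 4F) (c 5F)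

  sixOf-cong : ∀ {c c′} → (∀ w → c w ≡ c′ w) → sixOf c ≡ sixOf c′
  sixOf-cong c≡c′ = cong₂ (λ (x₀ , x₁ , x₂) (x₃ , x₄ , x₅) → six x₀ x₁ x₂ x₃ x₄ x₅)
    (cong₂ _,_ (c≡c′ 0F) (cong₂ _,_ (c≡c′ 1F) (c≡c′ 2F))) (cong₂ _,_ (c≡c′ 3F) (cong₂ _,_ (c≡c′ 4F) (c≡c′ 5F)))

  withSix : (Fin (6 + k) → Colour) → Six → Fin (6 + k) → Colour
  withSix c t 0F = Six.x₀ t
  withSix c t 1F = Six.x₁ t
  withSix c t 2F = Six.x₂ t
  withSix c t 3F = Six.x₃ t
  withSix c t 4F = Six.x₄ t
  withSix c t 5F = Six.x₅ t
  withSix c t (suc (suc (suc (suc (suc (suc w)))))) = c (suc (suc (suc (suc (suc (suc w))))))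

  Ψ : (Fin (6 + k) → Colour) → Fin (6 + k) → Colour
  Ψ c = withSix c (untwist (sixOf c))

  transversal⇒Twisted : ∀ c → isTransversalᵇ Twist.R c ≡ true → Twisted (sixOf c)
  transversal⇒Twisted c transversal = record
    { x₀≢x₁ = proper 0F 1F refl ; x₀≁x₂ = proper 0F 2F refl ; x₁≢x₄ = proper 1F 4F refl ; x₁≢x₅ = proper 1F 5F refl
    ; x₂≢x₃ = proper 2F 3F refl ; x₂≢x₄ = proper 2F 4F refl ; x₃≢x₄ = proper 3F 4F refl ; x₃≢x₅ = proper 3F 5F refl
    ; x₄≢x₅ = proper 4F 5F refl }
    where proper = Twist.transversal⇒twisted-proper c transversal

  Proper⇒transversal : ∀ c → Proper (sixOf c) → isTransversalᵇ Ident.R c ≡ true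
  Proper⇒transversal c proper = Ident.twisted-proper⇒transversal c λ u v adjacent → case (edge-view u v adjacent)
    where
    open Respects proper
    on-edge : ∀ {u v} → Edge u v → c u ≢ c v
    on-edge e01 = x₀≢x₁
    on-edge e02 = x₀≁x₂
    on-edge e14 = x₁≢x₄
    on-edge e15 = x₁≢x₅
    on-edge e23 = x₂≢x₃
    on-edge e24 = x₂≢x₄
    on-edge e34 = x₃≢x₄
    on-edge e35 = x₃≢x₅
    on-edge e45 = x₄≢x₅
    case : ∀ {u v} → Edge u v ⊎ Edge v u → c u ≢ c v
    case (inj₁ uv) = on-edge uv
    case (inj₂ vu) = ≢-sym (on-edge vu)

  Ψ-injective : ∀ c c′ → isTransversalᵇ Twist.R c ≡ true → isTransversalᵇ Twist.R c′ ≡ true →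
    (∀ w → Ψ c w ≡ Ψ c′ w) → ∀ w → c w ≡ c′ w
  Ψ-injective c c′ transversal transversal′ Ψc≡Ψc′ = pointwise
    where
    six≡ : sixOf c ≡ sixOf c′
    six≡ = trans (sym (retwist∘untwist (sixOf c) (transversal⇒Twisted c transversal)))
          (trans (cong retwist (sixOf-cong Ψc≡Ψc′)) (retwist∘untwist (sixOf c′) (transversal⇒Twisted c′ transversal′)))
    pointwise : ∀ w → c w ≡ c′ w
    pointwise 0F = cong Six.x₀ six≡
    pointwise 1F = cong Six.x₁ six≡
    pointwise 2F = cong Six.x₂ six≡
    pointwise 3F = cong Six.x₃ six≡
    pointwise 4F = cong Six.x₄ six≡
    pointwise 5F = cong Six.x₅ six≡
    pointwise w@(suc (suc (suc (suc (suc (suc _)))))) = Ψc≡Ψc′ w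

  missedSix : Six
  missedSix = six 1F 0F 0F 4F 1F 2F

  missed : Fin (6 + k) → Colour
  missed = withSix (λ _ → 0F) missedSix

  missed-proper : isTransversalᵇ Ident.R missed ≡ true
  missed-proper = Proper⇒transversal missed (record
    { x₀≢x₁ = λ () ; x₀≁x₂ = λ () ; x₁≢x₄ = λ () ; x₁≢x₅ = λ () ; x₂≢x₃ = λ ()
    ; x₂≢x₄ = λ () ; x₃≢x₄ = λ () ; x₃≢x₅ = λ () ; x₄≢x₅ = λ () })

  Ψ-misses : ∀ c → isTransversalᵇ Twist.R c ≡ true → ¬ (∀ w → Ψ c w ≡ missed w)
  Ψ-misses c transversal Ψc≡missed = untwist-retwist-missed (trans (cong untwist (sym sixOf-c)) untwist≡)
    where
    untwist≡ : untwist (sixOf c) ≡ missedSix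
    untwist≡ = sixOf-cong Ψc≡missed
    sixOf-c : sixOf c ≡ retwist missedSix
    sixOf-c = trans (sym (retwist∘untwist (sixOf c) (transversal⇒Twisted c transversal))) (cong retwist untwist≡)
    untwist-retwist-missed : untwist (retwist missedSix) ≢ missedSix
    untwist-retwist-missed ()

  numHColorings<P : numHColorings (cover Twist.fullCover) < P (Γ k) (5 + M)
  numHColorings<P = subst₂ _<_ (sym (numHColorings≡numTransversals (cover Twist.fullCover))) (sym Ident.P≡numTransversals)
    (viaΨ.count-< missed missed-proper λ y c y≈missed transversal → Bool.¬-not λ y≈Ψc →
      Ψ-misses c transversal (λ w → trans (sym (pointwise-==⁻ y (Ψ c) y≈Ψc w)) (pointwise-==⁻ y missed y≈missed w)))
    where
    colours = colourings (6 + k) (5 + M)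
    module viaΨ = CountAlongInjection (isTransversalᵇ Twist.R) (isTransversalᵇ Ident.R)
      (pointwiseᵇ _==_) (pointwiseᵇ _==_) Ψ colours colours
      (λ c → ≤-reflexive (colourings-unique (6 + k) (5 + M) c))
      (λ c → ≤-reflexive (sym (colourings-unique (6 + k) (5 + M) c)))
      (λ c c′ c≈c′ → trans (isTransversalᵇ-respects Ident.R c c′ (pointwise-==⁻ c c′ c≈c′)))
      (λ c transversal → Proper⇒transversal (Ψ c) (untwist-proper (sixOf c) (transversal⇒Twisted c transversal)))
      (λ y c c′ transversal transversal′ y≈Ψc y≈Ψc′ → pointwise-==⁺ (Ψ-injective c c′ transversal transversal′
        (λ w → trans (sym (pointwise-==⁻ y (Ψ c) y≈Ψc w)) (pointwise-==⁻ y (Ψ c′) y≈Ψc′ w))))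

Γ-PDP<P : ∀ k m → 5 ≤ m → Σ ℕ λ p → IsPDP (Γ k) m p × p < P (Γ k) m
Γ-PDP<P k (suc (suc (suc (suc (suc M))))) (s≤s (s≤s (s≤s (s≤s (s≤s _))))) =
  proj₁ pdp , proj₂ pdp , ≤-<-trans (proj₂ (proj₂ pdp) Twisted.Twist.fullCover) Twisted.numHColorings<P
  where
  module Twisted = TwistedCover k M
  pdp = PDP-exists (Γ k) Twisted.Twist.fullCover

theorem1p8 : (K : ℕ) → Σ ℕ λ n → K ≤ n × Σ (Graph n) λ G →
               IsχDP G 3
               × IsPDP G 3 (P G 3)
               × (Σ ℕ λ N → (m : ℕ) → N ≤ m → Σ ℕ λ k → IsPDP G m k × k < P G m)
theorem1p8 K = 6 + K , m≤n+m K 6 , Γ K , Γ-χDP K , Γ-PDP-3 K , 5 , Γ-PDP<P K
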